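{- Let $a,b$ be integers with $a+1\le b\le 2a$. Then the rooted graph $T_3(a,b)$ is a balanced $K_3$-tree with rooted density $\frac{3b}{a+b}$.
   Context: A rooted graph $(F,R)$ is a graph $F$ with a set $R\subseteq V(F)$ of roots. For nonempty $S\subseteq V(F)\setminus R$, $d(S)=e(S)/|S|$ where $e(S)$ is the number of edges with at least one endpoint in $S$; the rooted density of $(F,R)$ is $d(V(F)\setminus R)$; $(F,R)$ is balanced if $d(S)\ge d(V(F)\setminus R)$ for all nonempty $S\subseteq V(F)\setminus R$. A graph $T$ is a $K_t$-tree if there are subgraphs $K^{(1)},\dots,K^{(m)}$ of $T$ isomorphic to $K_t$ covering $V(T)$ such that for each $2\le i\le m$ there is $j<i$ with $V(K^{(i)})\cap(V(K^{(1)})\cup\dots\cup V(K^{(i-1)}))=V(K^{(i)})\cap V(K^{(j)})$, this intersection being neither empty nor all of $V(K^{(i)})$. The Bukh–Conlon tree $T_2(a,b)$ ($b>a\ge1$) is obtained from a path $u_1,\dots,u_a$ of non-root vertices by attaching a new root leaf to $u_i$ once for each time $i$ appears in the sequence $\lfloor1+j\frac{a}{b-a}\rfloor$ ($j=0,\dots,b-a-1$) followed by $a$; it has $b$ edges. $T_3(a,b)$ (for $a+1\le b$) is obtained from $T_2(a,b)$ by adding, for each edge $uv$ of $T_2(a,b)$, a new non-root vertex adjacent to exactly $u$ and $v$; the vertices of $T_2(a,b)$ keep their root/non-root status. -}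

module Defs where

open import Data.Bool using (Bool; true; false; _∧_; _∨_; not; if_then_else_)
open import Data.Nat as ℕ using (ℕ; zero; suc; _+_; _*_; _∸_; _≡ᵇ_; _<ᵇ_; _≤ᵇ_)
open import Data.Nat.DivMod using (_/_)
open import Data.Integer using (+_)
open import Data.Rational as ℚ using (ℚ; 0ℚ)
open import Data.Fin using (Fin; toℕ; _<_)
open import Data.Fin.Subset using (Subset; _∈_; _∩_; ⋃; Nonempty; ∣_∣; _⊆_)
open import Data.List as List using (List; []; _∷_; _++_; filter; allFin; cartesianProduct; length; upTo)
open import Data.Bool.ListAction using (any)
open import Data.Vec using (tabulate)
open import Data.Product using (Σ; ∃; ∃-syntax; _×_; _,_; proj₁; proj₂)
open import Relation.Binary.PropositionalEquality using (_≡_; _≢_)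

-- Vertices are Fin size (identified with the naturals 0 … size-1);
-- the edge set is given by a list of pairs of naturals (endpoints < size),
-- read as unordered pairs; isRoot marks the roots.

record RootedGraph : Set where
  field
    size   : ℕ
    edges  : List (ℕ × ℕ)
    isRoot : ℕ → Bool

open RootedGraph public

adjB : List (ℕ × ℕ) → ℕ → ℕ → Bool
adjB es u v = any (λ e → ((proj₁ e ≡ᵇ u) ∧ (proj₂ e ≡ᵇ v)) ∨ ((proj₁ e ≡ᵇ v) ∧ (proj₂ e ≡ᵇ u))) es

Adj : (G : RootedGraph) → Fin (size G) → Fin (size G) → Set
Adj G u v = adjB (edges G) (toℕ u) (toℕ v) ≡ true

memB : ∀ {n} → Subset n → Fin n → Bool
memB (b Data.Vec.∷ _) Fin.zero = b
memB (_ Data.Vec.∷ p) (Fin.suc i) = memB p i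

eS : (G : RootedGraph) → Subset (size G) → ℕ
eS G S = length (List.filterᵇ ok (cartesianProduct (allFin (size G)) (allFin (size G))))
  where
  ok : Fin (size G) × Fin (size G) → Bool
  ok (u , v) = (toℕ u <ᵇ toℕ v) ∧ adjB (edges G) (toℕ u) (toℕ v) ∧ (memB S u ∨ memB S v)

-- m / k as a rational (with the irrelevant convention m / 0 = 0)
frac : ℕ → ℕ → ℚ
frac m zero = 0ℚ
frac m (suc k) = (+ m) ℚ./ suc k

density : (G : RootedGraph) → Subset (size G) → ℚ
density G S = frac (eS G S) ∣ S ∣

nonRoots : (G : RootedGraph) → Subset (size G)
nonRoots G = tabulate (λ i → not (isRoot G (toℕ i)))

rootedDensity : RootedGraph → ℚ
rootedDensity G = density G (nonRoots G)

Balanced : RootedGraph → Set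
Balanced G = ∀ (S : Subset (size G)) → S ⊆ nonRoots G → Nonempty S →
  rootedDensity G ℚ.≤ density G S

IsClique : (t : ℕ) (G : RootedGraph) → Subset (size G) → Set
IsClique t G K = (∣ K ∣ ≡ t) ×
  (∀ u v → u ∈ K → v ∈ K → u ≢ v → Adj G u v)

earlier : ∀ {n m} → (Fin m → Subset n) → Fin m → Subset n
earlier {m = m} K i = ⋃ (List.map K (List.filterᵇ (λ j → toℕ j <ᵇ toℕ i) (allFin m)))

IsKTree : (t : ℕ) → RootedGraph → Set
IsKTree t G = ∃[ m ] Σ (Fin m → Subset (size G)) λ K →
  (∀ i → IsClique t G (K i)) ×
  (∀ (v : Fin (size G)) → ∃[ i ] v ∈ K i) ×
  (∀ (i : Fin m) → 0 ℕ.< toℕ i → ∃[ j ] (j < i) ×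
      ((K i ∩ earlier K i) ≡ (K i ∩ K j)) ×
      Nonempty (K i ∩ K j) ×
      ((K i ∩ K j) ≢ K i))

-- natural division with the (irrelevant) convention m / 0 = 0
quot : ℕ → ℕ → ℕ
quot m zero = 0
quot m (suc d) = m / suc d

-- T₂(a,b): vertex u_i (1 ≤ i ≤ a) is index i-1; root leaves are indices
-- a + k for k = 0 … b-a.  For k < b-a, leaf a+k is attached to
-- u_{⌊1 + k a/(b-a)⌋}, i.e. index ⌊k a/(b-a)⌋; leaf a+(b-a) = b is
-- attached to u_a (index a-1).
T₂ : ℕ → ℕ → RootedGraph
T₂ a b = record
  { size   = suc b
  ; edges  = List.map (λ i → (i , suc i)) (upTo (a ∸ 1))
             ++ List.map (λ k → (a + k , quot (k * a) (b ∸ a))) (upTo (b ∸ a))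
             ++ ((b , a ∸ 1) ∷ [])
  ; isRoot = λ v → a ≤ᵇ v
  }

triangles : ℕ → List (ℕ × ℕ) → List (ℕ × ℕ)
triangles k [] = []
triangles k ((u , v) ∷ es) = (u , k) ∷ (v , k) ∷ triangles (suc k) es

addTriangles : RootedGraph → RootedGraph
addTriangles G = record
  { size   = size G + length (edges G)
  ; edges  = edges G ++ triangles (size G) (edges G)
  ; isRoot = λ v → (v <ᵇ size G) ∧ isRoot G v
  }

T₃ : ℕ → ℕ → RootedGraph
T₃ a b = addTriangles (T₂ a b)

-- Number T₂(a, b) so that its m-th edge joins vertex m + 1 to an earlier path vertex. The m-th
-- triangle of T₃(a, b) (edge m together with the vertex added on it) then meets the earlier triangles
-- exactly in that path vertex, so the triangles exhibit T₃(a, b) as a K₃-tree. Every edge of T₃(a, b)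
-- meets a non-root, so the rooted density is 3b / (a + b). For balance, split a set S of non-roots
-- into its path vertices and its new vertices. The path vertices are handled by the balance of T₂
-- (Bukh–Conlon): b |S ∩ path| ≤ a · e_{T₂}(S), proved by an invariant maintained along the path,
-- the leaves being spread over the path at rate (b − a) / a. Each triangle then satisfies
-- 3b [its new vertex ∈ S] + 3a [its T₂-edge meets S] ≤ (a + b) · (its edges meeting S),
-- and summing over the triangles gives 3b |S| ≤ (a + b) e(S).

module Submission where

open import Algebra.Properties.CommutativeSemigroup using (interchange)
open import Data.Bool using (Bool; true; false; _∧_; _∨_; not; T; if_then_else_)
open import Data.Bool.Properties using (∨-zeroʳ; ∧-zeroʳ; ∨-comm; ∧-comm; T?)
open import Data.Empty using (⊥-elim)
open import Data.Fin as Fin using (Fin; toℕ; fromℕ<)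
open import Data.Fin.Properties using (toℕ<n; toℕ-fromℕ<; toℕ-injective)
open import Data.Fin.Subset using (Subset; ∣_∣; _⊆_; _∩_; Nonempty; ⋃) renaming (_∈_ to _∈ₛ_)
open import Data.Fin.Subset.Properties
  using (drop-∷-⊆; ∣⁅x⁆∣≡1; p⊆q⇒∣p∣≤∣q∣; x∈⁅y⁆⇒x≡y; x∈p∪q⁺; x∈p∪q⁻; ∉⊥; ⊆-antisym; x∈p∩q⁺; x∈p∩q⁻)
import Data.Integer as ℤ
import Data.Integer.Properties as ℤP
open import Data.List as List using (List; []; _∷_; _++_; length; filterᵇ; cartesianProduct; tabulate; applyUpTo)
open import Data.List.Membership.Propositional using (_∈_)
open import Data.List.Membership.Propositional.Properties
  using (∈-map⁺; ∈-map⁻; ∈-filter⁺; ∈-filter⁻; ∈-allFin; ∈-++⁺ˡ; ∈-++⁺ʳ; ∈-applyUpTo⁺)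
open import Data.List.Properties using (map-applyUpTo; length-applyUpTo; map-++)
open import Data.List.Relation.Unary.All using (All; []; _∷_)
open import Data.List.Relation.Unary.All.Properties using (++⁺; applyUpTo⁺₁)
open import Data.List.Relation.Unary.Any using (here; there)
open import Data.Nat using (ℕ; zero; suc; _+_; _*_; _∸_; _≤_; _<_; _⊔_; _⊓_; _≡ᵇ_; _<ᵇ_; _≤ᵇ_; z≤n; s≤s; z<s)
open import Data.Nat.DivMod using (_/_; _%_; m*n/n≡m; /-monoˡ-≤; m<n*o⇒m/o<n; m/n*n≤m; m≡m%n+[m/n]*n; m%n<n)
open import Data.Nat.ListAction using (sum)
open import Data.Nat.ListAction.Properties using (sum-++)
open import Data.Nat.Properties
open import Data.Nat.Tactic.RingSolver using (solve-∀)
open import Data.Product using (_×_; _,_; proj₁; proj₂; ∃-syntax)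
open import Data.Rational as ℚ using (ℚ)
import Data.Rational.Properties as ℚP
import Data.Rational.Unnormalised as ℚᵘ
import Data.Rational.Unnormalised.Properties as ℚᵘP
open import Data.Sum using (_⊎_; inj₁; inj₂)
open import Data.Unit using (⊤; tt)
open import Data.Vec as Vec using ()
open import Data.Vec.Properties using ([]=⇒lookup; lookup⇒[]=; lookup∘tabulate)
open import Function using (_∘_)
open import Relation.Binary.Definitions using (tri<; tri≈; tri>)
open import Relation.Binary.PropositionalEquality
open import Relation.Nullary using (¬_; yes; no)

open import Defs

⟦_⟧ : Bool → ℕ
⟦ true ⟧ = 1
⟦ false ⟧ = 0

∑ : ℕ → (ℕ → ℕ) → ℕ
∑ zero f = 0
∑ (suc n) f = ∑ n f + f n

∑-cong : ∀ n {f g : ℕ → ℕ} → (∀ i → i < n → f i ≡ g i) → ∑ n f ≡ ∑ n g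
∑-cong zero eq = refl
∑-cong (suc n) eq = cong₂ _+_ (∑-cong n (λ i i<n → eq i (m≤n⇒m≤1+n i<n))) (eq n ≤-refl)

∑-mono-≤ : ∀ n {f g : ℕ → ℕ} → (∀ i → i < n → f i ≤ g i) → ∑ n f ≤ ∑ n g
∑-mono-≤ zero le = z≤n
∑-mono-≤ (suc n) le = +-mono-≤ (∑-mono-≤ n (λ i i<n → le i (m≤n⇒m≤1+n i<n))) (le n ≤-refl)

∑-distrib-+ : ∀ n (f g : ℕ → ℕ) → ∑ n (λ i → f i + g i) ≡ ∑ n f + ∑ n g
∑-distrib-+ zero f g = refl
∑-distrib-+ (suc n) f g = trans (cong (_+ (f n + g n)) (∑-distrib-+ n f g))
  (interchange +-commutativeSemigroup (∑ n f) (∑ n g) (f n) (g n))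

∑-distribˡ-* : ∀ n c (f : ℕ → ℕ) → ∑ n (λ i → c * f i) ≡ c * ∑ n f
∑-distribˡ-* zero c f = sym (*-zeroʳ c)
∑-distribˡ-* (suc n) c f = trans (cong (_+ c * f n) (∑-distribˡ-* n c f)) (sym (*-distribˡ-+ c (∑ n f) (f n)))

∑-split : ∀ m n (f : ℕ → ℕ) → ∑ (m + n) f ≡ ∑ m f + ∑ n (λ i → f (m + i))
∑-split m zero f = trans (cong (λ k → ∑ k f) (+-identityʳ m)) (sym (+-identityʳ (∑ m f)))
∑-split m (suc n) f = begin
  ∑ (m + suc n) f                                 ≡⟨ cong (λ k → ∑ k f) (+-suc m n) ⟩
  ∑ (m + n) f + f (m + n)                         ≡⟨ cong (_+ f (m + n)) (∑-split m n f) ⟩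
  ∑ m f + ∑ n (λ i → f (m + i)) + f (m + n)       ≡⟨ +-assoc (∑ m f) _ _ ⟩
  ∑ m f + ∑ (suc n) (λ i → f (m + i))             ∎
  where open ≡-Reasoning

∑-head : ∀ n (f : ℕ → ℕ) → ∑ (suc n) f ≡ f 0 + ∑ n (f ∘ suc)
∑-head n f = ∑-split 1 n f

∑-const : ∀ n c → ∑ n (λ _ → c) ≡ n * c
∑-const zero c = refl
∑-const (suc n) c = trans (cong (_+ c) (∑-const n c)) (+-comm (n * c) c)

∑-zero : ∀ n {f : ℕ → ℕ} → (∀ i → i < n → f i ≡ 0) → ∑ n f ≡ 0
∑-zero n eq = trans (∑-cong n eq) (trans (∑-const n 0) (*-zeroʳ n))

≡ᵇ-refl : ∀ m → (m ≡ᵇ m) ≡ true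
≡ᵇ-refl zero = refl
≡ᵇ-refl (suc m) = ≡ᵇ-refl m

≢⇒≡ᵇ≡false : ∀ {m n} → m ≢ n → (m ≡ᵇ n) ≡ false
≢⇒≡ᵇ≡false {zero} {zero} m≢n = ⊥-elim (m≢n refl)
≢⇒≡ᵇ≡false {zero} {suc n} _ = refl
≢⇒≡ᵇ≡false {suc m} {zero} _ = refl
≢⇒≡ᵇ≡false {suc m} {suc n} m≢n = ≢⇒≡ᵇ≡false (m≢n ∘ cong suc)

≡ᵇ≡true⇒≡ : ∀ m n → (m ≡ᵇ n) ≡ true → m ≡ n
≡ᵇ≡true⇒≡ m n eq = ≡ᵇ⇒≡ m n (subst T (sym eq) tt)

<⇒<ᵇ≡true : ∀ {m n} → m < n → (m <ᵇ n) ≡ true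
<⇒<ᵇ≡true {zero} {suc n} _ = refl
<⇒<ᵇ≡true {suc m} {suc n} (s≤s m<n) = <⇒<ᵇ≡true m<n

≥⇒<ᵇ≡false : ∀ {m n} → n ≤ m → (m <ᵇ n) ≡ false
≥⇒<ᵇ≡false {m} {zero} _ = refl
≥⇒<ᵇ≡false {suc m} {suc n} (s≤s n≤m) = ≥⇒<ᵇ≡false n≤m

≤⇒≤ᵇ≡true : ∀ {m n} → m ≤ n → (m ≤ᵇ n) ≡ true
≤⇒≤ᵇ≡true {zero} _ = refl
≤⇒≤ᵇ≡true {suc m} m<n = <⇒<ᵇ≡true m<n

>⇒≤ᵇ≡false : ∀ {m n} → n < m → (m ≤ᵇ n) ≡ false
>⇒≤ᵇ≡false {suc m} (s≤s n≤m) = ≥⇒<ᵇ≡false n≤m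

≡ᵇ∧≡ᵇ⇒≡ : ∀ a b c d → ((a ≡ᵇ b) ∧ (c ≡ᵇ d)) ≡ true → a ≡ b × c ≡ d
≡ᵇ∧≡ᵇ⇒≡ a b c d eq with a ≡ᵇ b in a≡b
... | true = ≡ᵇ≡true⇒≡ a b a≡b , ≡ᵇ≡true⇒≡ c d eq

∑-indicator : ∀ n {p} c → p < n → ∑ n (λ i → ⟦ i ≡ᵇ p ⟧ * c) ≡ c
∑-indicator (suc n) {p} c p<1+n with p ≟ n
... | yes refl = begin
  ∑ p (λ i → ⟦ i ≡ᵇ p ⟧ * c) + ⟦ p ≡ᵇ p ⟧ * c
    ≡⟨ cong₂ _+_ (∑-zero p (λ i i<p → cong (λ x → ⟦ x ⟧ * c) (≢⇒≡ᵇ≡false (<⇒≢ i<p))))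
                 (cong (λ x → ⟦ x ⟧ * c) (≡ᵇ-refl p)) ⟩
  0 + 1 * c ≡⟨ *-identityˡ c ⟩
  c ∎
  where open ≡-Reasoning
... | no p≢n = begin
  ∑ n (λ i → ⟦ i ≡ᵇ p ⟧ * c) + ⟦ n ≡ᵇ p ⟧ * c
    ≡⟨ cong₂ _+_ (∑-indicator n c (≤∧≢⇒< (≤-pred p<1+n) p≢n))
                 (cong (λ x → ⟦ x ⟧ * c) (≢⇒≡ᵇ≡false (p≢n ∘ sym))) ⟩
  c + 0 ≡⟨ +-identityʳ c ⟩
  c ∎
  where open ≡-Reasoning

∑-indicator₃ : ∀ n {x y w} → x ≢ y → x ≢ w → y ≢ w → x < n → y < n → w < n →
  ∑ n (λ v → ⟦ (v ≡ᵇ x) ∨ (v ≡ᵇ y) ∨ (v ≡ᵇ w) ⟧) ≡ 3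
∑-indicator₃ n {x} {y} {w} x≢y x≢w y≢w x<n y<n w<n = begin
  ∑ n (λ v → ⟦ (v ≡ᵇ x) ∨ (v ≡ᵇ y) ∨ (v ≡ᵇ w) ⟧)
    ≡⟨ ∑-cong n (λ v _ → split v) ⟩
  ∑ n (λ v → ⟦ v ≡ᵇ x ⟧ * 1 + (⟦ v ≡ᵇ y ⟧ * 1 + ⟦ v ≡ᵇ w ⟧ * 1))
    ≡⟨ ∑-distrib-+ n _ _ ⟩
  ∑ n (λ v → ⟦ v ≡ᵇ x ⟧ * 1) + ∑ n (λ v → ⟦ v ≡ᵇ y ⟧ * 1 + ⟦ v ≡ᵇ w ⟧ * 1)
    ≡⟨ cong (∑ n (λ v → ⟦ v ≡ᵇ x ⟧ * 1) +_) (∑-distrib-+ n _ _) ⟩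
  ∑ n (λ v → ⟦ v ≡ᵇ x ⟧ * 1) + (∑ n (λ v → ⟦ v ≡ᵇ y ⟧ * 1) + ∑ n (λ v → ⟦ v ≡ᵇ w ⟧ * 1))
    ≡⟨ cong₂ _+_ (∑-indicator n 1 x<n) (cong₂ _+_ (∑-indicator n 1 y<n) (∑-indicator n 1 w<n)) ⟩
  3 ∎
  where
  open ≡-Reasoning
  split : ∀ v → ⟦ (v ≡ᵇ x) ∨ (v ≡ᵇ y) ∨ (v ≡ᵇ w) ⟧
                ≡ ⟦ v ≡ᵇ x ⟧ * 1 + (⟦ v ≡ᵇ y ⟧ * 1 + ⟦ v ≡ᵇ w ⟧ * 1)
  split v with v ≡ᵇ x in v≡x | v ≡ᵇ y in v≡y | v ≡ᵇ w in v≡w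
  ... | true | true | _ = ⊥-elim (x≢y (trans (sym (≡ᵇ≡true⇒≡ v x v≡x)) (≡ᵇ≡true⇒≡ v y v≡y)))
  ... | true | false | true = ⊥-elim (x≢w (trans (sym (≡ᵇ≡true⇒≡ v x v≡x)) (≡ᵇ≡true⇒≡ v w v≡w)))
  ... | false | true | true = ⊥-elim (y≢w (trans (sym (≡ᵇ≡true⇒≡ v y v≡y)) (≡ᵇ≡true⇒≡ v w v≡w)))
  ... | true | false | false = refl
  ... | false | true | false = refl
  ... | false | false | true = refl
  ... | false | false | false = refl

-- Membership indexed by ℕ (false out of range), so that sums over vertices can range over ℕ.
memℕ : ∀ {n} → Subset n → ℕ → Bool
memℕ Vec.[] k = false
memℕ (x Vec.∷ p) zero = x
memℕ (x Vec.∷ p) (suc k) = memℕ p k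

memB≡memℕ : ∀ {n} (S : Subset n) i → memB S i ≡ memℕ S (toℕ i)
memB≡memℕ (x Vec.∷ S) Fin.zero = refl
memB≡memℕ (x Vec.∷ S) (Fin.suc i) = memB≡memℕ S i

memℕ-tabulate : ∀ n (f : ℕ → Bool) {k} → k < n → memℕ (Vec.tabulate {n = n} (f ∘ toℕ)) k ≡ f k
memℕ-tabulate (suc n) f {zero} _ = refl
memℕ-tabulate (suc n) f {suc k} (s≤s k<n) = memℕ-tabulate n (f ∘ suc) k<n

memℕ-⊆ : ∀ {n} {S T : Subset n} → S ⊆ T → ∀ v → memℕ S v ≡ true → memℕ T v ≡ true
memℕ-⊆ {S = x Vec.∷ S} {y Vec.∷ T} S⊆T zero refl = []=⇒lookup (S⊆T Vec.here)
memℕ-⊆ {S = x Vec.∷ S} {y Vec.∷ T} S⊆T (suc v) eq = memℕ-⊆ (drop-∷-⊆ S⊆T) v eq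

∣p∣≡∑ : ∀ {n} (S : Subset n) → ∣ S ∣ ≡ ∑ n (⟦_⟧ ∘ memℕ S)
∣p∣≡∑ {zero} Vec.[] = refl
∣p∣≡∑ {suc n} (true Vec.∷ S) = trans (cong suc (∣p∣≡∑ S)) (sym (∑-head n _))
∣p∣≡∑ {suc n} (false Vec.∷ S) = trans (∣p∣≡∑ S) (sym (∑-head n _))

nonempty⇒∣p∣>0 : ∀ {n} {S : Subset n} → Nonempty S → 0 < ∣ S ∣
nonempty⇒∣p∣>0 {S = S} (i , i∈S) = subst (_≤ ∣ S ∣) (∣⁅x⁆∣≡1 i)
  (p⊆q⇒∣p∣≤∣q∣ λ x∈⁅i⁆ → subst (_∈ₛ S) (sym (x∈⁅y⁆⇒x≡y i x∈⁅i⁆)) i∈S)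

∈-tabulate⁺ : ∀ {n} (f : Fin n → Bool) {v} → f v ≡ true → v ∈ₛ Vec.tabulate f
∈-tabulate⁺ f {v} fv = lookup⇒[]= v (Vec.tabulate f) (trans (lookup∘tabulate f v) fv)

∈-tabulate⁻ : ∀ {n} (f : Fin n → Bool) {v} → v ∈ₛ Vec.tabulate f → f v ≡ true
∈-tabulate⁻ f {v} v∈ = trans (sym (lookup∘tabulate f v)) ([]=⇒lookup v∈)

∈⋃⁺ : ∀ {n} {x : Fin n} {p} ps → p ∈ ps → x ∈ₛ p → x ∈ₛ ⋃ ps
∈⋃⁺ (q ∷ ps) (here refl) x∈p = x∈p∪q⁺ (inj₁ x∈p)
∈⋃⁺ (q ∷ ps) (there p∈ps) x∈p = x∈p∪q⁺ (inj₂ (∈⋃⁺ ps p∈ps x∈p))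

∈⋃⁻ : ∀ {n} {x : Fin n} ps → x ∈ₛ ⋃ ps → ∃[ p ] p ∈ ps × x ∈ₛ p
∈⋃⁻ [] x∈⊥ = ⊥-elim (∉⊥ x∈⊥)
∈⋃⁻ (p ∷ ps) x∈ with x∈p∪q⁻ p (⋃ ps) x∈
... | inj₁ x∈p = p , here refl , x∈p
... | inj₂ x∈⋃ = let q , q∈ps , x∈q = ∈⋃⁻ ps x∈⋃ in q , there q∈ps , x∈q

module _ {n m} (K : Fin m → Subset n) where

  private
    before : Fin m → Fin m → Bool
    before i k = toℕ k <ᵇ toℕ i

  ∈-earlier⁺ : ∀ {i j x} → j Fin.< i → x ∈ₛ K j → x ∈ₛ earlier K i
  ∈-earlier⁺ {i} {j} j<i =
    ∈⋃⁺ (List.map K (filterᵇ (before i) (List.allFin m)))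
        (∈-map⁺ K (∈-filter⁺ (T? ∘ before i) (∈-allFin j) (<⇒<ᵇ j<i)))

  ∈-earlier⁻ : ∀ {i x} → x ∈ₛ earlier K i → ∃[ j ] j Fin.< i × x ∈ₛ K j
  ∈-earlier⁻ {i} x∈ with ∈⋃⁻ (List.map K (filterᵇ (before i) (List.allFin m))) x∈
  ... | _ , p∈ , x∈p with ∈-map⁻ K p∈
  ...   | j , j∈ , refl =
    j , <ᵇ⇒< (toℕ j) (toℕ i) (proj₂ (∈-filter⁻ (T? ∘ before i) {xs = List.allFin m} j∈)) , x∈p

-- Counting the edges that meet a set of vertices

countᵇ : {A : Set} → (A → Bool) → List A → ℕ
countᵇ p xs = length (filterᵇ p xs)

countᵇ-∷ : {A : Set} (p : A → Bool) → ∀ x xs → countᵇ p (x ∷ xs) ≡ ⟦ p x ⟧ + countᵇ p xs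
countᵇ-∷ p x xs with p x
... | true = refl
... | false = refl

countᵇ-++ : {A : Set} (p : A → Bool) → ∀ xs ys → countᵇ p (xs ++ ys) ≡ countᵇ p xs + countᵇ p ys
countᵇ-++ p [] ys = refl
countᵇ-++ p (x ∷ xs) ys = begin
  countᵇ p (x ∷ xs ++ ys)                 ≡⟨ countᵇ-∷ p x (xs ++ ys) ⟩
  ⟦ p x ⟧ + countᵇ p (xs ++ ys)            ≡⟨ cong (⟦ p x ⟧ +_) (countᵇ-++ p xs ys) ⟩
  ⟦ p x ⟧ + (countᵇ p xs + countᵇ p ys)    ≡⟨ +-assoc ⟦ p x ⟧ _ _ ⟨
  ⟦ p x ⟧ + countᵇ p xs + countᵇ p ys      ≡⟨ cong (_+ countᵇ p ys) (countᵇ-∷ p x xs) ⟨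
  countᵇ p (x ∷ xs) + countᵇ p ys          ∎
  where open ≡-Reasoning

countᵇ-map : {A B : Set} (p : B → Bool) (f : A → B) → ∀ xs → countᵇ p (List.map f xs) ≡ countᵇ (p ∘ f) xs
countᵇ-map p f [] = refl
countᵇ-map p f (x ∷ xs) = trans (countᵇ-∷ p (f x) (List.map f xs))
  (trans (cong (⟦ p (f x) ⟧ +_) (countᵇ-map p f xs)) (sym (countᵇ-∷ (p ∘ f) x xs)))

countᵇ-cartesianProduct : {A B : Set} (p : A × B → Bool) → ∀ xs ys →
  countᵇ p (cartesianProduct xs ys) ≡ sum (List.map (λ x → countᵇ (λ y → p (x , y)) ys) xs)
countᵇ-cartesianProduct p [] ys = refl
countᵇ-cartesianProduct p (x ∷ xs) ys = trans (countᵇ-++ p (List.map (x ,_) ys) (cartesianProduct xs ys))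
  (cong₂ _+_ (countᵇ-map p (x ,_) ys) (countᵇ-cartesianProduct p xs ys))

sum-applyUpTo : ∀ (f : ℕ → ℕ) n → sum (List.applyUpTo f n) ≡ ∑ n f
sum-applyUpTo f zero = refl
sum-applyUpTo f (suc n) = trans (cong (f 0 +_) (sum-applyUpTo (f ∘ suc) n)) (sym (∑-head n f))

sum-map-tabulate : {A : Set} → ∀ n (f : Fin n → A) (h : A → ℕ) (H : ℕ → ℕ) →
  (∀ i → h (f i) ≡ H (toℕ i)) → sum (List.map h (tabulate f)) ≡ ∑ n H
sum-map-tabulate zero f h H eq = refl
sum-map-tabulate (suc n) f h H eq = begin
  h (f Fin.zero) + sum (List.map h (tabulate (f ∘ Fin.suc)))
    ≡⟨ cong₂ _+_ (eq Fin.zero) (sum-map-tabulate n (f ∘ Fin.suc) h (H ∘ suc) (eq ∘ Fin.suc)) ⟩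
  H 0 + ∑ n (H ∘ suc) ≡⟨ ∑-head n H ⟨
  ∑ (suc n) H ∎
  where open ≡-Reasoning

countᵇ-tabulate : {A : Set} → ∀ n (f : Fin n → A) (p : A → Bool) (q : ℕ → Bool) →
  (∀ i → p (f i) ≡ q (toℕ i)) → countᵇ p (tabulate f) ≡ ∑ n (⟦_⟧ ∘ q)
countᵇ-tabulate zero f p q eq = refl
countᵇ-tabulate (suc n) f p q eq = begin
  countᵇ p (tabulate f) ≡⟨ countᵇ-∷ p (f Fin.zero) (tabulate (f ∘ Fin.suc)) ⟩
  ⟦ p (f Fin.zero) ⟧ + countᵇ p (tabulate (f ∘ Fin.suc))
    ≡⟨ cong₂ _+_ (cong ⟦_⟧ (eq Fin.zero)) (countᵇ-tabulate n (f ∘ Fin.suc) p (q ∘ suc) (eq ∘ Fin.suc)) ⟩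
  ⟦ q 0 ⟧ + ∑ n (⟦_⟧ ∘ q ∘ suc) ≡⟨ ∑-head n (⟦_⟧ ∘ q) ⟨
  ∑ (suc n) (⟦_⟧ ∘ q) ∎
  where open ≡-Reasoning

joins : ℕ × ℕ → ℕ → ℕ → Bool
joins e u v = ((proj₁ e ≡ᵇ u) ∧ (proj₂ e ≡ᵇ v)) ∨ ((proj₁ e ≡ᵇ v) ∧ (proj₂ e ≡ᵇ u))

touches : (ℕ → Bool) → ℕ × ℕ → Bool
touches s e = s (proj₁ e) ∨ s (proj₂ e)

pairCount : ℕ → (ℕ → ℕ → Bool) → (ℕ → Bool) → ℕ
pairCount n adj s = ∑ n λ u → ∑ n λ v → ⟦ (u <ᵇ v) ∧ adj u v ∧ (s u ∨ s v) ⟧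

eS≡pairCount : (G : RootedGraph) (S : Subset (size G)) → eS G S ≡ pairCount (size G) (adjB (edges G)) (memℕ S)
eS≡pairCount G S = trans (countᵇ-cartesianProduct _ (List.allFin n) (List.allFin n))
  (sum-map-tabulate n (λ i → i) _ _ λ u → countᵇ-tabulate n (λ i → i) _ _ λ v →
    cong₂ (λ x y → (toℕ u <ᵇ toℕ v) ∧ adjB (edges G) (toℕ u) (toℕ v) ∧ (x ∨ y))
          (memB≡memℕ S u) (memB≡memℕ S v))
  where n = size G

joins-sym : ∀ x y u v → joins (x , y) u v ≡ joins (y , x) u v
joins-sym x y u v = trans (∨-comm ((x ≡ᵇ u) ∧ (y ≡ᵇ v)) ((x ≡ᵇ v) ∧ (y ≡ᵇ u)))
  (cong₂ _∨_ (∧-comm (x ≡ᵇ v) (y ≡ᵇ u)) (∧-comm (x ≡ᵇ u) (y ≡ᵇ v)))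

ordered-joins : (s : ℕ → Bool) → ∀ {x y} u v → x < y →
  ⟦ (u <ᵇ v) ∧ joins (x , y) u v ∧ (s u ∨ s v) ⟧ ≡ ⟦ u ≡ᵇ x ⟧ * (⟦ v ≡ᵇ y ⟧ * ⟦ s x ∨ s y ⟧)
ordered-joins s {x} {y} u v x<y with u ≟ x | v ≟ y
... | yes refl | yes refl rewrite <⇒<ᵇ≡true x<y | ≡ᵇ-refl u | ≡ᵇ-refl v =
  sym (trans (*-identityˡ _) (*-identityˡ _))
... | yes refl | no v≢y rewrite ≡ᵇ-refl u | ≢⇒≡ᵇ≡false (v≢y ∘ sym) | ≢⇒≡ᵇ≡false v≢y
      | ≢⇒≡ᵇ≡false {y} {u} (>⇒≢ x<y) | ∧-zeroʳ (u ≡ᵇ v) | ∧-zeroʳ (u <ᵇ v) = refl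
... | no u≢x | _ with v ≟ x | u ≟ y
...   | yes refl | yes refl rewrite ≥⇒<ᵇ≡false {u} {v} (<⇒≤ x<y) | ≢⇒≡ᵇ≡false u≢x = refl
...   | yes refl | no u≢y rewrite ≢⇒≡ᵇ≡false (u≢x ∘ sym) | ≢⇒≡ᵇ≡false u≢x | ≢⇒≡ᵇ≡false (u≢y ∘ sym)
        | ∧-zeroʳ (v ≡ᵇ v) | ∧-zeroʳ (u <ᵇ v) = refl
...   | no v≢x | _ rewrite ≢⇒≡ᵇ≡false (u≢x ∘ sym) | ≢⇒≡ᵇ≡false u≢x | ≢⇒≡ᵇ≡false (v≢x ∘ sym)
        | ∧-zeroʳ (u <ᵇ v) = refl

pairCount-joins< : ∀ n (s : ℕ → Bool) {x y} → x < y → y < n → pairCount n (joins (x , y)) s ≡ ⟦ s x ∨ s y ⟧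
pairCount-joins< n s {x} {y} x<y y<n = begin
  pairCount n (joins (x , y)) s
    ≡⟨ ∑-cong n (λ u _ → ∑-cong n (λ v _ → ordered-joins s u v x<y)) ⟩
  ∑ n (λ u → ∑ n (λ v → ⟦ u ≡ᵇ x ⟧ * (⟦ v ≡ᵇ y ⟧ * c)))
    ≡⟨ ∑-cong n (λ u _ → ∑-distribˡ-* n ⟦ u ≡ᵇ x ⟧ (λ v → ⟦ v ≡ᵇ y ⟧ * c)) ⟩
  ∑ n (λ u → ⟦ u ≡ᵇ x ⟧ * ∑ n (λ v → ⟦ v ≡ᵇ y ⟧ * c))
    ≡⟨ ∑-cong n (λ u _ → cong (⟦ u ≡ᵇ x ⟧ *_) (∑-indicator n c y<n)) ⟩
  ∑ n (λ u → ⟦ u ≡ᵇ x ⟧ * c)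
    ≡⟨ ∑-indicator n c (<-trans x<y y<n) ⟩
  c ∎
  where
  open ≡-Reasoning
  c = ⟦ s x ∨ s y ⟧

ProperEdge : ℕ → ℕ × ℕ → Set
ProperEdge n e = proj₁ e < n × proj₂ e < n × proj₁ e ≢ proj₂ e

pairCount-joins : ∀ n (s : ℕ → Bool) {e} → ProperEdge n e → pairCount n (joins e) s ≡ ⟦ touches s e ⟧
pairCount-joins n s {x , y} (x<n , y<n , x≢y) with <-cmp x y
... | tri< x<y _ _ = pairCount-joins< n s x<y y<n
... | tri≈ _ x≡y _ = ⊥-elim (x≢y x≡y)
... | tri> _ _ y<x = begin
  pairCount n (joins (x , y)) s
    ≡⟨ ∑-cong n (λ u _ → ∑-cong n (λ v _ →
         cong (λ j → ⟦ (u <ᵇ v) ∧ j ∧ (s u ∨ s v) ⟧) (joins-sym x y u v))) ⟩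
  pairCount n (joins (y , x)) s ≡⟨ pairCount-joins< n s y<x x<n ⟩
  ⟦ s y ∨ s x ⟧ ≡⟨ cong ⟦_⟧ (∨-comm (s y) (s x)) ⟩
  ⟦ s x ∨ s y ⟧ ∎
  where open ≡-Reasoning

pairCount-∨ : ∀ n (s : ℕ → Bool) (adj₁ adj₂ : ℕ → ℕ → Bool) →
  (∀ u v → adj₁ u v ≡ true → adj₂ u v ≡ false) →
  pairCount n (λ u v → adj₁ u v ∨ adj₂ u v) s ≡ pairCount n adj₁ s + pairCount n adj₂ s
pairCount-∨ n s adj₁ adj₂ disjoint = begin
  pairCount n (λ u v → adj₁ u v ∨ adj₂ u v) s
    ≡⟨ ∑-cong n (λ u _ → ∑-cong n (λ v _ →
         split (u <ᵇ v) (adj₁ u v) (adj₂ u v) (s u ∨ s v) (disjoint u v))) ⟩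
  ∑ n (λ u → ∑ n (λ v → term adj₁ u v + term adj₂ u v))
    ≡⟨ ∑-cong n (λ u _ → ∑-distrib-+ n (term adj₁ u) (term adj₂ u)) ⟩
  ∑ n (λ u → ∑ n (term adj₁ u) + ∑ n (term adj₂ u))
    ≡⟨ ∑-distrib-+ n (λ u → ∑ n (term adj₁ u)) (λ u → ∑ n (term adj₂ u)) ⟩
  pairCount n adj₁ s + pairCount n adj₂ s ∎
  where
  open ≡-Reasoning
  term : (ℕ → ℕ → Bool) → ℕ → ℕ → ℕ
  term adj u v = ⟦ (u <ᵇ v) ∧ adj u v ∧ (s u ∨ s v) ⟧
  split : ∀ l x y t → (x ≡ true → y ≡ false) →
          ⟦ l ∧ (x ∨ y) ∧ t ⟧ ≡ ⟦ l ∧ x ∧ t ⟧ + ⟦ l ∧ y ∧ t ⟧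
  split false x y t _ = refl
  split true false y t _ = refl
  split true true y t x⇒¬y rewrite x⇒¬y refl with t
  ... | true = refl
  ... | false = refl

DistinctEdges : List (ℕ × ℕ) → Set
DistinctEdges [] = ⊤
DistinctEdges (e ∷ es) = (∀ u v → joins e u v ≡ true → adjB es u v ≡ false) × DistinctEdges es

pairCount-adjB : ∀ n (s : ℕ → Bool) es → All (ProperEdge n) es → DistinctEdges es →
  pairCount n (adjB es) s ≡ sum (List.map (⟦_⟧ ∘ touches s) es)
pairCount-adjB n s [] [] _ = ∑-zero n (λ u _ → ∑-zero n (λ v _ → cong ⟦_⟧ (∧-zeroʳ (u <ᵇ v))))
pairCount-adjB n s (e ∷ es) (proper ∷ propers) (fresh , distinct) =
  trans (pairCount-∨ n s (joins e) (adjB es) fresh)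
        (cong₂ _+_ (pairCount-joins n s proper) (pairCount-adjB n s es propers distinct))

joins⇒≡ : ∀ e u v → joins e u v ≡ true →
  (proj₁ e ≡ u × proj₂ e ≡ v) ⊎ (proj₁ e ≡ v × proj₂ e ≡ u)
joins⇒≡ (x , y) u v eq with (x ≡ᵇ u) ∧ (y ≡ᵇ v) in x≡u∧y≡v
... | true = inj₁ (≡ᵇ∧≡ᵇ⇒≡ x u y v x≡u∧y≡v)
... | false = inj₂ (≡ᵇ∧≡ᵇ⇒≡ x v y u eq)

adjB-sym : ∀ es u v → adjB es u v ≡ adjB es v u
adjB-sym [] u v = refl
adjB-sym ((x , y) ∷ es) u v =
  cong₂ _∨_ (∨-comm ((x ≡ᵇ u) ∧ (y ≡ᵇ v)) ((x ≡ᵇ v) ∧ (y ≡ᵇ u))) (adjB-sym es u v)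

∈⇒adjB : ∀ {es u v} → (u , v) ∈ es → adjB es u v ≡ true
∈⇒adjB {u = u} {v} (here refl) rewrite ≡ᵇ-refl u | ≡ᵇ-refl v = refl
∈⇒adjB {e ∷ es} {u} {v} (there uv∈es) rewrite ∈⇒adjB {es} uv∈es = ∨-zeroʳ (joins e u v)

-- A symmetric key that strictly increases along an edge list shows that no edge is listed twice.
module KeyOrder (key : ℕ → ℕ → ℕ) (key-sym : ∀ u v → key u v ≡ key v u) where

  edgeKey : ℕ × ℕ → ℕ
  edgeKey e = key (proj₁ e) (proj₂ e)

  Ascending : ℕ → ℕ → List (ℕ × ℕ) → Set
  Ascending lo hi [] = lo ≤ hi
  Ascending lo hi (e ∷ es) = lo ≤ edgeKey e × Ascending (suc (edgeKey e)) hi es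

  joins⇒edgeKey : ∀ e u v → joins e u v ≡ true → edgeKey e ≡ key u v
  joins⇒edgeKey e u v eq with joins⇒≡ e u v eq
  ... | inj₁ (refl , refl) = refl
  ... | inj₂ (refl , refl) = key-sym v u

  adjB⇒≤key : ∀ {lo hi} es u v → Ascending lo hi es → adjB es u v ≡ true → lo ≤ key u v
  adjB⇒≤key (e ∷ es) u v (lo≤e , asc) adj with joins e u v in j
  ... | true = subst (_ ≤_) (joins⇒edgeKey e u v j) lo≤e
  ... | false = ≤-trans lo≤e (<⇒≤ (adjB⇒≤key es u v asc adj))

  ascending⇒distinct : ∀ {lo hi} es → Ascending lo hi es → DistinctEdges es
  ascending⇒distinct [] _ = tt
  ascending⇒distinct (e ∷ es) (_ , asc) = fresh , ascending⇒distinct es asc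
    where
    fresh : ∀ u v → joins e u v ≡ true → adjB es u v ≡ false
    fresh u v j with adjB es u v in adj
    ... | false = refl
    ... | true = ⊥-elim (<-irrefl (joins⇒edgeKey e u v j) (adjB⇒≤key es u v asc adj))

  ascending-weaken : ∀ {lo lo′ hi} es → lo ≤ lo′ → Ascending lo′ hi es → Ascending lo hi es
  ascending-weaken [] lo≤lo′ lo′≤hi = ≤-trans lo≤lo′ lo′≤hi
  ascending-weaken (e ∷ es) lo≤lo′ (lo′≤e , asc) = ≤-trans lo≤lo′ lo′≤e , asc

  ascending-++ : ∀ {lo mid hi} xs ys → Ascending lo mid xs → Ascending mid hi ys → Ascending lo hi (xs ++ ys)
  ascending-++ [] ys lo≤mid asc = ascending-weaken ys lo≤mid asc
  ascending-++ (x ∷ xs) ys (lo≤x , asc₁) asc₂ = lo≤x , ascending-++ xs ys asc₁ asc₂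

  ascending-applyUpTo : ∀ n c (f : ℕ → ℕ × ℕ) → (∀ i → i < n → edgeKey (f i) ≡ c + i) →
    Ascending c (c + n) (List.applyUpTo f n)
  ascending-applyUpTo zero c f keys = ≤-reflexive (sym (+-identityʳ c))
  ascending-applyUpTo (suc n) c f keys =
    ≤-reflexive (sym key₀) ,
    subst₂ (λ lo hi → Ascending lo hi (List.applyUpTo (f ∘ suc) n)) (cong suc (sym key₀)) (sym (+-suc c n))
      (ascending-applyUpTo n (suc c) (f ∘ suc) (λ i i<n → trans (keys (suc i) (s≤s i<n)) (+-suc c i)))
    where
    key₀ : edgeKey (f 0) ≡ c
    key₀ = trans (keys 0 z<s) (+-identityʳ c)

  ascending-triangles : ∀ n k c (f : ℕ → ℕ × ℕ) →
    (∀ i → i < n → edgeKey (proj₁ (f i) , k + i) ≡ c + 2 * i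
                 × edgeKey (proj₂ (f i) , k + i) ≡ suc (c + 2 * i)) →
    Ascending c (c + 2 * n) (triangles k (List.applyUpTo f n))
  ascending-triangles zero k c f keys = ≤-reflexive (sym (+-identityʳ c))
  ascending-triangles (suc n) k c f keys =
    ≤-reflexive (sym key₁) , ≤-reflexive (trans (cong suc key₁) (sym key₂)) ,
    subst₂ (λ lo hi → Ascending lo hi (triangles (suc k) (List.applyUpTo (f ∘ suc) n)))
      (cong suc (sym key₂)) (shift-hi c n)
      (ascending-triangles n (suc k) (2 + c) (f ∘ suc) λ i i<n →
        let keys₁ , keys₂ = keys (suc i) (s≤s i<n) in
        trans (cong (key (proj₁ (f (suc i)))) (sym (+-suc k i))) (trans keys₁ (shift c i)) ,
        trans (cong (key (proj₂ (f (suc i)))) (sym (+-suc k i))) (trans keys₂ (cong suc (shift c i))))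
    where
    key₁ : key (proj₁ (f 0)) k ≡ c
    key₁ = trans (cong (key (proj₁ (f 0))) (sym (+-identityʳ k)))
                 (trans (proj₁ (keys 0 z<s)) (+-identityʳ c))
    key₂ : key (proj₂ (f 0)) k ≡ suc c
    key₂ = trans (cong (key (proj₂ (f 0))) (sym (+-identityʳ k)))
                 (trans (proj₂ (keys 0 z<s)) (cong suc (+-identityʳ c)))
    shift-hi : ∀ c n → 2 + c + 2 * n ≡ c + 2 * suc n
    shift-hi = solve-∀
    shift : ∀ c i → c + 2 * suc i ≡ 2 + c + 2 * i
    shift = solve-∀

sum-map-triangles : ∀ (h : ℕ × ℕ → ℕ) n k (f : ℕ → ℕ × ℕ) →
  sum (List.map h (triangles k (List.applyUpTo f n))) ≡ ∑ n (λ i → h (proj₁ (f i) , k + i) + h (proj₂ (f i) , k + i))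
sum-map-triangles h zero k f = refl
sum-map-triangles h (suc n) k f = begin
  sum (List.map h (triangles k (List.applyUpTo f (suc n))))
    ≡⟨ +-assoc (h (proj₁ (f 0) , k)) _ _ ⟨
  H′ k 0 + sum (List.map h (triangles (suc k) (List.applyUpTo (f ∘ suc) n)))
    ≡⟨ cong₂ _+_ (cong (λ w → H′ w 0) (sym (+-identityʳ k))) (sum-map-triangles h n (suc k) (f ∘ suc)) ⟩
  H 0 + ∑ n (λ i → H′ (suc k + i) (suc i))
    ≡⟨ cong (H 0 +_) (∑-cong n (λ i _ → cong (λ w → H′ w (suc i)) (sym (+-suc k i)))) ⟩
  H 0 + ∑ n (H ∘ suc) ≡⟨ ∑-head n H ⟨
  ∑ (suc n) H ∎
  where
  open ≡-Reasoning
  H′ : ℕ → ℕ → ℕ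
  H′ w i = h (proj₁ (f i) , w) + h (proj₂ (f i) , w)
  H : ℕ → ℕ
  H i = H′ (k + i) i

All-triangles : ∀ {P : ℕ × ℕ → Set} n k (f : ℕ → ℕ × ℕ) →
  (∀ i → i < n → P (proj₁ (f i) , k + i) × P (proj₂ (f i) , k + i)) → All P (triangles k (List.applyUpTo f n))
All-triangles zero k f Pf = []
All-triangles {P} (suc n) k f Pf =
  subst (λ w → P (proj₁ (f 0) , w)) (+-identityʳ k) (proj₁ (Pf 0 z<s)) ∷
  subst (λ w → P (proj₂ (f 0) , w)) (+-identityʳ k) (proj₂ (Pf 0 z<s)) ∷
  All-triangles n (suc k) (f ∘ suc) (λ i i<n →
    subst (λ w → P (proj₁ (f (suc i)) , w) × P (proj₂ (f (suc i)) , w)) (+-suc k i) (Pf (suc i) (s≤s i<n)))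

∈-triangles : ∀ n k (f : ℕ → ℕ × ℕ) {i} → i < n →
  (proj₁ (f i) , k + i) ∈ triangles k (List.applyUpTo f n) × (proj₂ (f i) , k + i) ∈ triangles k (List.applyUpTo f n)
∈-triangles (suc n) k f {zero} _ =
  here (cong (proj₁ (f 0) ,_) (+-identityʳ k)) , there (here (cong (proj₂ (f 0) ,_) (+-identityʳ k)))
∈-triangles (suc n) k f {suc i} (s≤s i<n) =
  there (there (subst (λ w → (proj₁ (f (suc i)) , w) ∈ rest) (sym (+-suc k i)) (proj₁ x∈,y∈))) ,
  there (there (subst (λ w → (proj₂ (f (suc i)) , w) ∈ rest) (sym (+-suc k i)) (proj₂ x∈,y∈)))
  where
  rest = triangles (suc k) (List.applyUpTo (f ∘ suc) n)
  x∈,y∈ = ∈-triangles n (suc k) (f ∘ suc) i<n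

-- The balance inequality for T₂

≤quot : ∀ {m j d} → 0 < d → j * d ≤ m → j ≤ quot m d
≤quot {m} {j} {suc d} _ j*d≤m = subst (_≤ m / suc d) (m*n/n≡m j (suc d)) (/-monoˡ-≤ (suc d) j*d≤m)

quot< : ∀ {m n d} → 0 < d → m < n * d → quot m d < n
quot< {d = suc d} _ m<n*d = m<n*o⇒m/o<n m<n*d

quot0≡0 : ∀ d → quot 0 d ≡ 0
quot0≡0 zero = refl
quot0≡0 (suc d) = refl

-- T₂(a, a + d) minus its last leaf: leaf k < d hangs on path vertex ⌊ka/d⌋, so the leaves on u_j
-- are those k with ⌈jd/a⌉ ≤ k < ⌈(j+1)d/a⌉; firstLeaf j = ⌈jd/a⌉.
module LeafDistribution (a′ d : ℕ) (0<d : 0 < d) (d≤a : d ≤ suc a′) where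

  a : ℕ
  a = suc a′

  leafParent : ℕ → ℕ
  leafParent k = quot (k * a) d

  firstLeaf : ℕ → ℕ
  firstLeaf j = (j * d + a′) / a

  firstLeaf-lower : ∀ j → j * d ≤ a * firstLeaf j
  firstLeaf-lower j = +-cancelʳ-≤ a′ (j * d) (a * q) (begin
    j * d + a′                   ≡⟨ m≡m%n+[m/n]*n (j * d + a′) a ⟩
    (j * d + a′) % a + q * a     ≤⟨ +-monoˡ-≤ (q * a) (≤-pred (m%n<n (j * d + a′) a)) ⟩
    a′ + q * a                   ≡⟨ cong (a′ +_) (*-comm q a) ⟩
    a′ + a * q                   ≡⟨ +-comm a′ (a * q) ⟩
    a * q + a′                   ∎)
    where
    open ≤-Reasoning
    q = firstLeaf j

  firstLeaf-upper : ∀ j → a * firstLeaf j < j * d + a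
  firstLeaf-upper j = begin-strict
    a * firstLeaf j              ≡⟨ *-comm a (firstLeaf j) ⟩
    firstLeaf j * a              ≤⟨ m/n*n≤m (j * d + a′) a ⟩
    j * d + a′                   <⟨ +-monoʳ-< (j * d) (n<1+n a′) ⟩
    j * d + a                    ∎
    where open ≤-Reasoning

  firstLeaf-1 : firstLeaf 1 ≡ 1
  firstLeaf-1 = ≤-antisym (≤-pred (*-cancelˡ-< a (firstLeaf 1) 2 (begin-strict
    a * firstLeaf 1              <⟨ firstLeaf-upper 1 ⟩
    1 * d + a                    ≡⟨ cong (_+ a) (*-identityˡ d) ⟩
    d + a                        ≤⟨ +-monoˡ-≤ a d≤a ⟩
    a + a                        ≡⟨ cong (a +_) (+-identityʳ a) ⟨
    2 * a                        ≡⟨ *-comm 2 a ⟩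
    a * 2                        ∎)))
    (n≢0⇒n>0 λ F₁≡0 → <⇒≱ 0<d (begin
      d                  ≡⟨ *-identityˡ d ⟨
      1 * d              ≤⟨ firstLeaf-lower 1 ⟩
      a * firstLeaf 1    ≡⟨ cong (a *_) F₁≡0 ⟩
      a * 0              ≡⟨ *-zeroʳ a ⟩
      0                  ∎))
    where open ≤-Reasoning

  firstLeaf-a : firstLeaf a ≡ d
  firstLeaf-a = ≤-antisym
    (≤-pred (*-cancelˡ-< a (firstLeaf a) (suc d)
      (<-≤-trans (firstLeaf-upper a) (≤-reflexive (trans (+-comm (a * d) a) (sym (*-suc a d)))))))
    (*-cancelˡ-≤ a (firstLeaf-lower a))

  firstLeaf-mono : ∀ j → firstLeaf j ≤ firstLeaf (suc j)
  firstLeaf-mono j = ≤-pred (*-cancelˡ-< a (firstLeaf j) (suc (firstLeaf (suc j))) (begin-strict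
    a * firstLeaf j                  <⟨ firstLeaf-upper j ⟩
    j * d + a                        ≤⟨ +-monoˡ-≤ a (m≤n+m (j * d) d) ⟩
    suc j * d + a                    ≤⟨ +-monoˡ-≤ a (firstLeaf-lower (suc j)) ⟩
    a * firstLeaf (suc j) + a        ≡⟨ +-comm _ a ⟩
    a + a * firstLeaf (suc j)        ≡⟨ *-suc a (firstLeaf (suc j)) ⟨
    a * suc (firstLeaf (suc j))      ∎))
    where open ≤-Reasoning

  leafParent-≡ : ∀ {j k} → firstLeaf j ≤ k → k < firstLeaf (suc j) → leafParent k ≡ j
  leafParent-≡ {j} {k} lo hi = ≤-antisym (≤-pred (quot< 0<d k*a<[1+j]*d)) (≤quot 0<d j*d≤k*a)
    where
    open ≤-Reasoning
    j*d≤k*a : j * d ≤ k * a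
    j*d≤k*a = begin
      j * d             ≤⟨ firstLeaf-lower j ⟩
      a * firstLeaf j   ≤⟨ *-monoʳ-≤ a lo ⟩
      a * k             ≡⟨ *-comm a k ⟩
      k * a             ∎
    k*a<[1+j]*d : k * a < suc j * d
    k*a<[1+j]*d = +-cancelʳ-< a (k * a) (suc j * d) (begin-strict
      k * a + a               ≡⟨ cong (_+ a) (*-comm k a) ⟩
      a * k + a               ≡⟨ +-comm (a * k) a ⟩
      a + a * k               ≡⟨ *-suc a k ⟨
      a * suc k               ≤⟨ *-monoʳ-≤ a hi ⟩
      a * firstLeaf (suc j)   <⟨ firstLeaf-upper (suc j) ⟩
      suc j * d + a           ∎)

  leafParent-< : ∀ {k} → k < d → leafParent k < a
  leafParent-< {k} k<d = quot< 0<d (subst (k * a <_) (*-comm d a) (*-monoˡ-< a k<d))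

  -- Invariant after the path vertices u_0 … u_j, with J = j + 1 and F = firstLeaf J: C counts the
  -- vertices of S among them, P and L the path and leaf edges so far that meet S. When u_j ∈ S, the
  -- edge u_j u_{j+1} will meet S whatever comes next; the invariant banks it, minus the rounding loss aF − Jd.
  Slack : Bool → (C P L F J : ℕ) → Set
  Slack false C P L F J = (a + d) * C ≤ a * (P + L)
  Slack true  C P L F J = (a + d) * C + a * F ≤ a * (P + L) + a + J * d

  slack-start : ∀ x → Slack x (0 + ⟦ x ⟧) 0 ⟦ x ⟧ 1 1
  slack-start false = ≤-reflexive (trans (*-zeroʳ (a + d)) (sym (*-zeroʳ a)))
  slack-start true = ≤-reflexive (start a d)
    where
    start : ∀ a d → (a + d) * (0 + 1) + a * 1 ≡ a * (0 + 1) + a + 1 * d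
    start = solve-∀

  slack-step : ∀ x y {C P L F t J} → J * d ≤ a * F → a * F < J * d + a → Slack x C P L F J →
    Slack y (C + ⟦ y ⟧) (P + ⟦ x ∨ y ⟧) (L + t * ⟦ y ⟧) (F + t) (suc J)
  slack-step false false {C} {P} {L} {F} {t} _ _ slack = subst₂ _≤_ (lhs a d C) (rhs a P L t) slack
    where
    lhs : ∀ a d C → (a + d) * C ≡ (a + d) * (C + 0)
    lhs = solve-∀
    rhs : ∀ a P L t → a * (P + L) ≡ a * (P + 0 + (L + t * 0))
    rhs = solve-∀
  slack-step true false {C} {P} {L} {F} {t} {J} J*d≤a*F _ slack =
    subst₂ _≤_ (lhs a d C) (rhs a P L t)
      (+-cancelʳ-≤ (a * F) _ _ (≤-trans slack (+-monoʳ-≤ (a * (P + L) + a) J*d≤a*F)))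
    where
    lhs : ∀ a d C → (a + d) * C ≡ (a + d) * (C + 0)
    lhs = solve-∀
    rhs : ∀ a P L t → a * (P + L) + a ≡ a * (P + 1 + (L + t * 0))
    rhs = solve-∀
  slack-step false true {C} {P} {L} {F} {t} {J} _ a*F<J*d+a slack =
    subst₂ _≤_ (lhs a d C F t) (rhs a d P L t J)
      (+-mono-≤ slack (+-monoˡ-≤ (a + d + a * t) (<⇒≤ a*F<J*d+a)))
    where
    lhs : ∀ a d C F t → (a + d) * C + (a * F + (a + d + a * t)) ≡ (a + d) * (C + 1) + a * (F + t)
    lhs = solve-∀
    rhs : ∀ a d P L t J → a * (P + L) + (J * d + a + (a + d + a * t)) ≡ a * (P + 1 + (L + t * 1)) + a + suc J * d
    rhs = solve-∀
  slack-step true true {C} {P} {L} {F} {t} {J} _ _ slack =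
    subst₂ _≤_ (lhs a d C F t) (rhs a d P L t J) (+-monoˡ-≤ (a + d + a * t) slack)
    where
    lhs : ∀ a d C F t → (a + d) * C + a * F + (a + d + a * t) ≡ (a + d) * (C + 1) + a * (F + t)
    lhs = solve-∀
    rhs : ∀ a d P L t J → a * (P + L) + a + J * d + (a + d + a * t) ≡ a * (P + 1 + (L + t * 1)) + a + suc J * d
    rhs = solve-∀

  slack-finish : ∀ x {C P L} → Slack x C P L d a → (a + d) * C ≤ a * (P + L + ⟦ x ⟧)
  slack-finish false {C} {P} {L} slack = subst ((a + d) * C ≤_) (cong (a *_) (sym (+-identityʳ (P + L)))) slack
  slack-finish true {C} {P} {L} slack =
    +-cancelʳ-≤ (a * d) _ _ (subst ((a + d) * C + a * d ≤_) (finish a P L (a * d)) slack)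
    where
    finish : ∀ a P L x → a * (P + L) + a + x ≡ a * (P + L + 1) + x
    finish = solve-∀

  module _ (s : ℕ → Bool) where

    pathVertices : ℕ → ℕ
    pathVertices j = ∑ (suc j) (⟦_⟧ ∘ s)

    pathEdges : ℕ → ℕ
    pathEdges j = ∑ j (λ i → ⟦ s i ∨ s (suc i) ⟧)

    leafEdges : ℕ → ℕ
    leafEdges n = ∑ n (λ k → ⟦ s (leafParent k) ⟧)

    leafEdges-step : ∀ j → leafEdges (firstLeaf (suc j)) ≡
      leafEdges (firstLeaf j) + (firstLeaf (suc j) ∸ firstLeaf j) * ⟦ s j ⟧
    leafEdges-step j = begin
      ∑ (firstLeaf (suc j)) leaf             ≡⟨ cong (λ n → ∑ n leaf) (m+[n∸m]≡n (firstLeaf-mono j)) ⟨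
      ∑ (firstLeaf j + t) leaf               ≡⟨ ∑-split (firstLeaf j) t leaf ⟩
      leafEdges (firstLeaf j) + ∑ t (λ i → leaf (firstLeaf j + i))
        ≡⟨ cong (leafEdges (firstLeaf j) +_) (∑-cong t λ i i<t → cong (⟦_⟧ ∘ s) (leafParent-≡ (m≤m+n _ i)
             (subst (firstLeaf j + i <_) (m+[n∸m]≡n (firstLeaf-mono j)) (+-monoʳ-< (firstLeaf j) i<t)))) ⟩
      leafEdges (firstLeaf j) + ∑ t (λ _ → ⟦ s j ⟧)
        ≡⟨ cong (leafEdges (firstLeaf j) +_) (∑-const t ⟦ s j ⟧) ⟩
      leafEdges (firstLeaf j) + t * ⟦ s j ⟧  ∎
      where
      open ≡-Reasoning
      leaf = λ k → ⟦ s (leafParent k) ⟧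
      t = firstLeaf (suc j) ∸ firstLeaf j

    slack : ∀ j → Slack (s j) (pathVertices j) (pathEdges j) (leafEdges (firstLeaf (suc j))) (firstLeaf (suc j)) (suc j)
    slack zero = subst₂ (λ L F → Slack (s 0) (pathVertices 0) 0 L F 1)
      (sym leafEdges₀) (sym firstLeaf-1) (slack-start (s 0))
      where
      leafEdges₀ : leafEdges (firstLeaf 1) ≡ ⟦ s 0 ⟧
      leafEdges₀ rewrite firstLeaf-1 | quot0≡0 d = refl
    slack (suc j) =
      subst₂ (λ L F → Slack (s (suc j)) (pathVertices (suc j)) (pathEdges (suc j)) L F (2 + j))
        (sym (leafEdges-step (suc j))) (m+[n∸m]≡n (firstLeaf-mono (suc j)))
        (slack-step (s j) (s (suc j)) (firstLeaf-lower (suc j)) (firstLeaf-upper (suc j)) (slack j))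

    balanced : (a + d) * ∑ a (⟦_⟧ ∘ s) ≤ a * (pathEdges a′ + leafEdges d + ⟦ s a′ ⟧)
    balanced = slack-finish (s a′) (subst₂ (λ L F → Slack (s a′) (pathVertices a′) (pathEdges a′) L F a)
      (cong leafEdges firstLeaf-a) firstLeaf-a (slack a′))

-- Only the case where the new vertex w is the sole vertex of its triangle in S needs b ≤ 2a.
triangle-balance : ∀ {a b} → a ≤ b → b ≤ 2 * a → ∀ x y w →
  3 * b * ⟦ w ⟧ + 3 * a * ⟦ x ∨ y ⟧ ≤ (a + b) * (⟦ x ∨ y ⟧ + (⟦ x ∨ w ⟧ + ⟦ y ∨ w ⟧))
triangle-balance {a} {b} a≤b b≤2a = balance
  where
  all : ∀ a b → 3 * b * 1 + 3 * a * 1 ≡ (a + b) * (1 + (1 + 1))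
  all = solve-∀
  onlyEdge : 3 * b * 0 + 3 * a * 1 ≤ (a + b) * (1 + (1 + 0))
  onlyEdge = subst₂ _≤_ (lhs a b) (rhs a b) (+-monoʳ-≤ (2 * a) (≤-trans a≤b (m≤m+n b (b + 0))))
    where
    lhs : ∀ a b → 2 * a + a ≡ 3 * b * 0 + 3 * a * 1
    lhs = solve-∀
    rhs : ∀ a b → 2 * a + (b + (b + 0)) ≡ (a + b) * (1 + (1 + 0))
    rhs = solve-∀
  balance : ∀ x y w →
    3 * b * ⟦ w ⟧ + 3 * a * ⟦ x ∨ y ⟧ ≤ (a + b) * (⟦ x ∨ y ⟧ + (⟦ x ∨ w ⟧ + ⟦ y ∨ w ⟧))
  balance true true true = ≤-reflexive (all a b)
  balance true false true = ≤-reflexive (all a b)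
  balance false true true = ≤-reflexive (all a b)
  balance false false true = subst₂ _≤_ (lhs a b) (rhs a b) (+-monoˡ-≤ (2 * b) b≤2a)
    where
    lhs : ∀ a b → b + 2 * b ≡ 3 * b * 1 + 3 * a * 0
    lhs = solve-∀
    rhs : ∀ a b → 2 * a + 2 * b ≡ (a + b) * (0 + (1 + 1))
    rhs = solve-∀
  balance true true false = subst₂ _≤_ (lhs a b) (rhs a b) (m≤m+n (3 * a) (3 * b))
    where
    lhs : ∀ a b → 3 * a ≡ 3 * b * 0 + 3 * a * 1
    lhs = solve-∀
    rhs : ∀ a b → 3 * a + 3 * b ≡ (a + b) * (1 + (1 + 1))
    rhs = solve-∀
  balance true false false = onlyEdge
  balance false true false = onlyEdge
  balance false false false = ≤-reflexive (none a b)
    where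
    none : ∀ a b → 3 * b * 0 + 3 * a * 0 ≡ (a + b) * (0 + (0 + 0))
    none = solve-∀

-- The graph T₃(a, b): edges, rooted density and balance

frac-≤ : ∀ p q {m n} → 0 < m → 0 < n → p * n ≤ q * m → frac p m ℚ.≤ frac q n
frac-≤ p q {suc m} {suc n} _ _ p*n≤q*m = ℚP.toℚᵘ-cancel-≤
  (ℚᵘP.≤-respʳ-≃ (ℚᵘP.≃-sym (ℚP.toℚᵘ-fromℚᵘ (ℚᵘ.mkℚᵘ (ℤ.+ q) n)))
  (ℚᵘP.≤-respˡ-≃ (ℚᵘP.≃-sym (ℚP.toℚᵘ-fromℚᵘ (ℚᵘ.mkℚᵘ (ℤ.+ p) m)))
    (ℚᵘ.*≤* (subst₂ ℤ._≤_ (ℤP.pos-* p (suc n)) (ℤP.pos-* q (suc m)) (ℤ.+≤+ p*n≤q*m)))))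

applyUpTo-+ : ∀ {A : Set} (f : ℕ → A) m n → applyUpTo f (m + n) ≡ applyUpTo f m ++ applyUpTo (λ i → f (m + i)) n
applyUpTo-+ f zero n = refl
applyUpTo-+ f (suc m) n = cong (f 0 ∷_) (applyUpTo-+ (f ∘ suc) m n)

applyUpTo-cong : ∀ {A : Set} n {f g : ℕ → A} → (∀ i → i < n → f i ≡ g i) → applyUpTo f n ≡ applyUpTo g n
applyUpTo-cong zero eq = refl
applyUpTo-cong (suc n) eq = cong₂ _∷_ (eq 0 z<s) (applyUpTo-cong n (λ i i<n → eq (suc i) (s≤s i<n)))

module BukhConlon (a′ b : ℕ) (a+1≤b : suc a′ + 1 ≤ b) (b≤2a : b ≤ 2 * suc a′) where

  a : ℕ
  a = suc a′

  d : ℕ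
  d = b ∸ a

  a<b : a < b
  a<b = subst (_≤ b) (+-comm a 1) a+1≤b

  a+d≡b : a + d ≡ b
  a+d≡b = m+[n∸m]≡n (<⇒≤ a<b)

  0<d : 0 < d
  0<d = subst (_≤ d) (m+n∸m≡n a 1) (∸-monoˡ-≤ a a+1≤b)

  d≤a : d ≤ a
  d≤a = subst (d ≤_) (m+n∸m≡n a a) (∸-monoˡ-≤ a (subst (b ≤_) (cong (a +_) (+-identityʳ a)) b≤2a))

  open LeafDistribution a′ d 0<d d≤a using (leafParent; leafParent-<; pathEdges; leafEdges; balanced)

  edge : ℕ → ℕ × ℕ
  edge m = if m <ᵇ a′ then (m , suc m)
           else if (m ∸ a′) <ᵇ d then (a + (m ∸ a′) , leafParent (m ∸ a′))
           else (b , a′)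

  edge-path : ∀ {m} → m < a′ → edge m ≡ (m , suc m)
  edge-path m<a′ rewrite <⇒<ᵇ≡true m<a′ = refl

  edge-leaf : ∀ {k} → k < d → edge (a′ + k) ≡ (a + k , leafParent k)
  edge-leaf {k} k<d rewrite ≥⇒<ᵇ≡false {a′ + k} {a′} (m≤m+n a′ k) | m+n∸m≡n a′ k | <⇒<ᵇ≡true k<d = refl

  edge-last : edge (a′ + d) ≡ (b , a′)
  edge-last rewrite ≥⇒<ᵇ≡false {a′ + d} {a′} (m≤m+n a′ d) | m+n∸m≡n a′ d | ≥⇒<ᵇ≡false {d} {d} ≤-refl = refl

  T₂-edges : edges (T₂ a b) ≡ applyUpTo edge b
  T₂-edges = begin
    List.map (λ i → (i , suc i)) (List.upTo a′) ++
      List.map (λ k → (a + k , leafParent k)) (List.upTo d) ++ (b , a′) ∷ []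
      ≡⟨ cong₂ _++_ (map-applyUpTo (λ i → i) _ a′)
                    (cong (_++ (b , a′) ∷ []) (map-applyUpTo (λ i → i) _ d)) ⟩
    applyUpTo (λ i → (i , suc i)) a′ ++ applyUpTo (λ k → (a + k , leafParent k)) d ++ (b , a′) ∷ []
      ≡⟨ cong₂ _++_ (applyUpTo-cong a′ (λ _ → sym ∘ edge-path))
           (cong₂ _++_ (applyUpTo-cong d (λ _ → sym ∘ edge-leaf))
                       (cong (_∷ []) (sym (trans (cong (edge ∘ (a′ +_)) (+-identityʳ d)) edge-last)))) ⟩
    applyUpTo edge a′ ++ applyUpTo (edge ∘ (a′ +_)) d ++ applyUpTo (λ i → edge (a′ + (d + i))) 1
      ≡⟨ cong (applyUpTo edge a′ ++_) (applyUpTo-+ (edge ∘ (a′ +_)) d 1) ⟨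
    applyUpTo edge a′ ++ applyUpTo (edge ∘ (a′ +_)) (d + 1)
      ≡⟨ applyUpTo-+ edge a′ (d + 1) ⟨
    applyUpTo edge (a′ + (d + 1))
      ≡⟨ cong (applyUpTo edge) (trans (cong (a′ +_) (+-comm d 1)) (trans (+-suc a′ d) a+d≡b)) ⟩
    applyUpTo edge b ∎
    where open ≡-Reasoning

  record Hangs (m : ℕ) : Set where
    field
      parent : ℕ
      parent≤m : parent ≤ m
      parent<a : parent < a
      orient : edge m ≡ (parent , suc m) ⊎ edge m ≡ (suc m , parent)

  hangs : ∀ {m} → m < b → Hangs m
  hangs {m} m<b with m <? a′
  ... | yes m<a′ = record
    { parent = m ; parent≤m = ≤-refl ; parent<a = m≤n⇒m≤1+n m<a′ ; orient = inj₁ (edge-path m<a′) }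
  ... | no m≮a′ = leafOrLast (m ∸ a′) (sym (m+[n∸m]≡n (≮⇒≥ m≮a′)))
    where
    leafOrLast : ∀ k → m ≡ a′ + k → Hangs m
    leafOrLast k refl with k <? d
    ... | yes k<d = record
      { parent = leafParent k ; parent≤m = ≤-trans (≤-pred (leafParent-< k<d)) (m≤m+n a′ k)
      ; parent<a = leafParent-< k<d ; orient = inj₂ (edge-leaf k<d) }
    ... | no k≮d = record
      { parent = a′ ; parent≤m = m≤m+n a′ k ; parent<a = ≤-refl
      ; orient = inj₂ (trans (cong (edge ∘ (a′ +_)) k≡d)
                        (trans edge-last (cong (_, a′) (trans (sym a+d≡b) (cong (a +_) (sym k≡d)))))) }
      where
      k≡d : k ≡ d
      k≡d = ≤-antisym
        (≤-pred (+-cancelˡ-< a′ k (suc d) (subst (a′ + k <_) (trans (sym a+d≡b) (sym (+-suc a′ d))) m<b)))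
        (≮⇒≥ k≮d)

  edge-≤ : ∀ {m} → m < b → proj₁ (edge m) ≤ suc m × proj₂ (edge m) ≤ suc m
  edge-≤ m<b with hangs m<b
  ... | record { parent≤m = p≤m ; orient = inj₁ eq } rewrite eq = m≤n⇒m≤1+n p≤m , ≤-refl
  ... | record { parent≤m = p≤m ; orient = inj₂ eq } rewrite eq = ≤-refl , m≤n⇒m≤1+n p≤m

  edge-loopless : ∀ {m} → m < b → proj₁ (edge m) ≢ proj₂ (edge m)
  edge-loopless m<b with hangs m<b
  ... | record { parent≤m = p≤m ; orient = inj₁ eq } rewrite eq = λ p≡1+m → <-irrefl p≡1+m (s≤s p≤m)
  ... | record { parent≤m = p≤m ; orient = inj₂ eq } rewrite eq = λ 1+m≡p → <-irrefl (sym 1+m≡p) (s≤s p≤m)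

  edge-≤b : ∀ {m} → m < b → proj₁ (edge m) ≤ b × proj₂ (edge m) ≤ b
  edge-≤b m<b = ≤-trans (proj₁ (edge-≤ m<b)) m<b , ≤-trans (proj₂ (edge-≤ m<b)) m<b

  -- Edge m of T₂ gets key m + 1 (its larger endpoint); the two edges from the vertex b + 1 + m added
  -- on it get b + 1 + 2m and b + 2 + 2m. Keys then increase along the edge list of T₃(a, b).
  key : ℕ → ℕ → ℕ
  key u v = if (u ⊔ v) ≤ᵇ b then u ⊔ v
            else suc b + 2 * ((u ⊔ v) ∸ suc b) + ⟦ (u ⊓ v) ≡ᵇ proj₂ (edge ((u ⊔ v) ∸ suc b)) ⟧

  key-sym : ∀ u v → key u v ≡ key v u
  key-sym u v rewrite ⊔-comm u v | ⊓-comm u v = refl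

  open KeyOrder key key-sym

  key-hang : ∀ {p m} → p ≤ m → suc m ≤ b → key p (suc m) ≡ suc m
  key-hang p≤m 1+m≤b rewrite m≤n⇒m⊔n≡n (m≤n⇒m≤1+n p≤m) | ≤⇒≤ᵇ≡true 1+m≤b = refl

  key-edge : ∀ {m} → m < b → edgeKey (edge m) ≡ suc m
  key-edge {m} m<b with hangs m<b
  ... | record { parent≤m = p≤m ; orient = inj₁ eq } rewrite eq = key-hang p≤m m<b
  ... | record { parent = p ; parent≤m = p≤m ; orient = inj₂ eq } rewrite eq =
    trans (key-sym (suc m) p) (key-hang p≤m m<b)

  key-side : ∀ {x} m → x ≤ b → key x (suc b + m) ≡ suc b + 2 * m + ⟦ x ≡ᵇ proj₂ (edge m) ⟧
  key-side {x} m x≤b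
    rewrite m≤n⇒m⊔n≡n (≤-trans (m≤n⇒m≤1+n x≤b) (m≤m+n (suc b) m))
          | m≤n⇒m⊓n≡m (≤-trans (m≤n⇒m≤1+n x≤b) (m≤m+n (suc b) m))
          | >⇒≤ᵇ≡false {suc b + m} {b} (s≤s (m≤m+n b m)) | m+n∸m≡n (suc b) m = refl

  T₃-edgeList : List (ℕ × ℕ)
  T₃-edgeList = applyUpTo edge b ++ triangles (suc b) (applyUpTo edge b)

  T₃-edges : edges (T₃ a b) ≡ T₃-edgeList
  T₃-edges = cong (λ es → es ++ triangles (suc b) es) T₂-edges

  T₃-size : size (T₃ a b) ≡ suc b + b
  T₃-size = cong (suc b +_) (trans (cong length T₂-edges) (length-applyUpTo edge b))

  T₃-ascending : Ascending 1 (suc b + 2 * b) T₃-edgeList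
  T₃-ascending = ascending-++ (applyUpTo edge b) _
    (ascending-applyUpTo b 1 edge (λ _ → key-edge))
    (ascending-triangles b (suc b) (suc b) edge sideKeys)
    where
    sideKeys : ∀ m → m < b → edgeKey (proj₁ (edge m) , suc b + m) ≡ suc b + 2 * m
                           × edgeKey (proj₂ (edge m) , suc b + m) ≡ suc (suc b + 2 * m)
    sideKeys m m<b =
      trans (key-side m (proj₁ (edge-≤b m<b)))
        (trans (cong (λ x → suc b + 2 * m + ⟦ x ⟧) (≢⇒≡ᵇ≡false (edge-loopless m<b))) (+-identityʳ _)) ,
      trans (key-side m (proj₂ (edge-≤b m<b)))
        (trans (cong (λ x → suc b + 2 * m + ⟦ x ⟧) (≡ᵇ-refl (proj₂ (edge m)))) (+-comm _ 1))

  T₃-proper : All (ProperEdge (size (T₃ a b))) T₃-edgeList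
  T₃-proper = subst (λ n → All (ProperEdge n) T₃-edgeList) (sym T₃-size)
    (++⁺ (applyUpTo⁺₁ edge b λ m<b →
           ≤-<-trans (proj₁ (edge-≤b m<b)) b<n , ≤-<-trans (proj₂ (edge-≤b m<b)) b<n , edge-loopless m<b)
         (All-triangles b (suc b) edge λ m m<b → side (proj₁ (edge-≤b m<b)) m<b , side (proj₂ (edge-≤b m<b)) m<b))
    where
    b<n : b < suc b + b
    b<n = s≤s (m≤m+n b b)
    side : ∀ {x m} → x ≤ b → m < b → ProperEdge (suc b + b) (x , suc b + m)
    side {x} {m} x≤b m<b = ≤-<-trans x≤b b<n , +-monoʳ-< (suc b) m<b ,
      λ x≡ → <-irrefl x≡ (s≤s (≤-trans x≤b (m≤m+n b m)))

  touch : ∀ {n} → Subset n → ℕ × ℕ → ℕ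
  touch S e = ⟦ touches (memℕ S) e ⟧

  sides : ∀ {n} → Subset n → ℕ → ℕ
  sides S m = touch S (proj₁ (edge m) , suc b + m) + touch S (proj₂ (edge m) , suc b + m)

  eS-T₃ : ∀ (S : Subset (size (T₃ a b))) → eS (T₃ a b) S ≡ ∑ b (touch S ∘ edge) + ∑ b (sides S)
  eS-T₃ S = begin
    eS (T₃ a b) S                                      ≡⟨ eS≡pairCount (T₃ a b) S ⟩
    pairCount n (adjB (edges (T₃ a b))) (memℕ S)
      ≡⟨ cong (λ es → pairCount n (adjB es) (memℕ S)) T₃-edges ⟩
    pairCount n (adjB T₃-edgeList) (memℕ S)
      ≡⟨ pairCount-adjB n (memℕ S) T₃-edgeList T₃-proper (ascending⇒distinct T₃-edgeList T₃-ascending) ⟩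
    sum (List.map (touch S) T₃-edgeList)               ≡⟨ cong sum (map-++ (touch S) (applyUpTo edge b) _) ⟩
    sum (List.map (touch S) (applyUpTo edge b) ++ List.map (touch S) (triangles (suc b) (applyUpTo edge b)))
      ≡⟨ sum-++ (List.map (touch S) (applyUpTo edge b)) _ ⟩
    sum (List.map (touch S) (applyUpTo edge b)) + sum (List.map (touch S) (triangles (suc b) (applyUpTo edge b)))
      ≡⟨ cong₂ _+_ (trans (cong sum (map-applyUpTo edge (touch S) b)) (sum-applyUpTo (touch S ∘ edge) b))
                   (sum-map-triangles (touch S) b (suc b) edge) ⟩
    ∑ b (touch S ∘ edge) + ∑ b (sides S) ∎
    where
    open ≡-Reasoning
    n = size (T₃ a b)

  ∑-T₃ : ∀ (f : ℕ → ℕ) →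
    ∑ (size (T₃ a b)) f ≡ ∑ a f + ∑ (suc d) (f ∘ (a +_)) + ∑ b (f ∘ (suc b +_))
  ∑-T₃ f = begin
    ∑ (size (T₃ a b)) f                        ≡⟨ cong (λ n → ∑ n f) T₃-size ⟩
    ∑ (suc b + b) f                            ≡⟨ ∑-split (suc b) b f ⟩
    ∑ (suc b) f + ∑ b (f ∘ (suc b +_))         ≡⟨ cong (λ n → ∑ n f + ∑ b (f ∘ (suc b +_))) 1+b≡a+[1+d] ⟩
    ∑ (a + suc d) f + ∑ b (f ∘ (suc b +_))     ≡⟨ cong (_+ ∑ b (f ∘ (suc b +_))) (∑-split a (suc d) f) ⟩
    ∑ a f + ∑ (suc d) (f ∘ (a +_)) + ∑ b (f ∘ (suc b +_)) ∎
    where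
    open ≡-Reasoning
    1+b≡a+[1+d] : suc b ≡ a + suc d
    1+b≡a+[1+d] = trans (cong suc (sym a+d≡b)) (sym (+-suc a d))

  nonRoot : ℕ → Bool
  nonRoot = memℕ (nonRoots (T₃ a b))

  nonRoot-≡ : ∀ {v} → v < suc b + b → nonRoot v ≡ not ((v <ᵇ suc b) ∧ (a ≤ᵇ v))
  nonRoot-≡ {v} v<n = memℕ-tabulate (size (T₃ a b)) (not ∘ isRoot (T₃ a b)) (subst (v <_) (sym T₃-size) v<n)

  ≤b⇒<size : ∀ {v} → v ≤ b → v < suc b + b
  ≤b⇒<size v≤b = s≤s (≤-trans v≤b (m≤m+n b b))

  nonRoot-path : ∀ {v} → v < a → nonRoot v ≡ true
  nonRoot-path {v} v<a = trans (nonRoot-≡ (≤b⇒<size (≤-trans (<⇒≤ v<a) (<⇒≤ a<b))))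
    (cong not (trans (cong ((v <ᵇ suc b) ∧_) (>⇒≤ᵇ≡false v<a)) (∧-zeroʳ _)))

  nonRoot-new : ∀ {m} → m < b → nonRoot (suc b + m) ≡ true
  nonRoot-new {m} m<b
    rewrite nonRoot-≡ (+-monoʳ-< (suc b) m<b) | ≥⇒<ᵇ≡false {suc b + m} {suc b} (m≤m+n (suc b) m) = refl

  root-leaf : ∀ {v} → a ≤ v → v ≤ b → nonRoot v ≡ false
  root-leaf {v} a≤v v≤b
    rewrite nonRoot-≡ (≤b⇒<size v≤b) | <⇒<ᵇ≡true {v} {suc b} (s≤s v≤b) | ≤⇒≤ᵇ≡true a≤v = refl

  leaf≤b : ∀ {i} → i < suc d → a + i ≤ b
  leaf≤b {i} i<1+d = subst (a + i ≤_) a+d≡b (+-monoʳ-≤ a (≤-pred i<1+d))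

  eS-nonRoots : eS (T₃ a b) (nonRoots (T₃ a b)) ≡ 3 * b
  eS-nonRoots = begin
    eS (T₃ a b) (nonRoots (T₃ a b))    ≡⟨ eS-T₃ (nonRoots (T₃ a b)) ⟩
    ∑ b (touch (nonRoots (T₃ a b)) ∘ edge) + ∑ b (sides (nonRoots (T₃ a b)))
      ≡⟨ cong₂ _+_ (trans (∑-cong b λ _ → edge-touched) (∑-const b 1))
                   (trans (∑-cong b λ _ → sides-touched) (∑-const b 2)) ⟩
    b * 1 + b * 2                      ≡⟨ b+2b≡3b b ⟩
    3 * b                              ∎
    where
    open ≡-Reasoning
    b+2b≡3b : ∀ b → b * 1 + b * 2 ≡ 3 * b
    b+2b≡3b = solve-∀
    edge-touched : ∀ {m} → m < b → touch (nonRoots (T₃ a b)) (edge m) ≡ 1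
    edge-touched m<b with hangs m<b
    ... | record { parent<a = p<a ; orient = inj₁ eq } rewrite eq | nonRoot-path p<a = refl
    ... | record { parent<a = p<a ; orient = inj₂ eq } rewrite eq | nonRoot-path p<a = cong ⟦_⟧ (∨-zeroʳ _)
    sides-touched : ∀ {m} → m < b → sides (nonRoots (T₃ a b)) m ≡ 2
    sides-touched {m} m<b rewrite nonRoot-new m<b =
      cong₂ _+_ (cong ⟦_⟧ (∨-zeroʳ (nonRoot (proj₁ (edge m)))))
                (cong ⟦_⟧ (∨-zeroʳ (nonRoot (proj₂ (edge m)))))

  ∣nonRoots∣ : ∣ nonRoots (T₃ a b) ∣ ≡ a + b
  ∣nonRoots∣ = begin
    ∣ nonRoots (T₃ a b) ∣                       ≡⟨ ∣p∣≡∑ (nonRoots (T₃ a b)) ⟩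
    ∑ (size (T₃ a b)) (⟦_⟧ ∘ nonRoot)           ≡⟨ ∑-T₃ (⟦_⟧ ∘ nonRoot) ⟩
    ∑ a (⟦_⟧ ∘ nonRoot) + ∑ (suc d) (⟦_⟧ ∘ nonRoot ∘ (a +_)) + ∑ b (⟦_⟧ ∘ nonRoot ∘ (suc b +_))
      ≡⟨ cong₂ _+_ (cong₂ _+_ (trans (∑-cong a (λ _ → cong ⟦_⟧ ∘ nonRoot-path)) (∑-const a 1))
                              (∑-zero (suc d) (λ i i<1+d → cong ⟦_⟧ (root-leaf (m≤m+n a i) (leaf≤b i<1+d)))))
                   (trans (∑-cong b (λ _ → cong ⟦_⟧ ∘ nonRoot-new)) (∑-const b 1)) ⟩
    a * 1 + 0 + b * 1                           ≡⟨ simplify a b ⟩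
    a + b                                       ∎
    where
    open ≡-Reasoning
    simplify : ∀ a b → a * 1 + 0 + b * 1 ≡ a + b
    simplify = solve-∀

  rootedDensity-T₃ : rootedDensity (T₃ a b) ≡ frac (3 * b) (a + b)
  rootedDensity-T₃ = cong₂ frac eS-nonRoots ∣nonRoots∣

  module Balance (S : Subset (size (T₃ a b))) (S⊆nonRoots : S ⊆ nonRoots (T₃ a b)) where

    s : ℕ → Bool
    s = memℕ S

    s-leaf : ∀ {v} → a ≤ v → v ≤ b → s v ≡ false
    s-leaf {v} a≤v v≤b with s v in sv
    ... | false = refl
    ... | true with trans (sym (memℕ-⊆ S⊆nonRoots v sv)) (root-leaf a≤v v≤b)
    ...   | ()

    ∣S∣≡ : ∣ S ∣ ≡ ∑ a (⟦_⟧ ∘ s) + ∑ b (⟦_⟧ ∘ s ∘ (suc b +_))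
    ∣S∣≡ = begin
      ∣ S ∣                           ≡⟨ ∣p∣≡∑ S ⟩
      ∑ (size (T₃ a b)) (⟦_⟧ ∘ s)      ≡⟨ ∑-T₃ (⟦_⟧ ∘ s) ⟩
      ∑ a (⟦_⟧ ∘ s) + ∑ (suc d) (⟦_⟧ ∘ s ∘ (a +_)) + ∑ b (⟦_⟧ ∘ s ∘ (suc b +_))
        ≡⟨ cong (λ x → ∑ a (⟦_⟧ ∘ s) + x + ∑ b (⟦_⟧ ∘ s ∘ (suc b +_)))
             (∑-zero (suc d) λ i i<1+d → cong ⟦_⟧ (s-leaf (m≤m+n a i) (leaf≤b i<1+d))) ⟩
      ∑ a (⟦_⟧ ∘ s) + 0 + ∑ b (⟦_⟧ ∘ s ∘ (suc b +_))
        ≡⟨ cong (_+ ∑ b (⟦_⟧ ∘ s ∘ (suc b +_))) (+-identityʳ _) ⟩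
      ∑ a (⟦_⟧ ∘ s) + ∑ b (⟦_⟧ ∘ s ∘ (suc b +_)) ∎
      where open ≡-Reasoning

    T₂-touching : ∑ b (touch S ∘ edge) ≡ pathEdges s a′ + leafEdges s d + ⟦ s a′ ⟧
    T₂-touching = begin
      ∑ b τ                                             ≡⟨ cong (λ n → ∑ n τ) b≡a′+[d+1] ⟩
      ∑ (a′ + (d + 1)) τ                                 ≡⟨ ∑-split a′ (d + 1) τ ⟩
      ∑ a′ τ + ∑ (d + 1) (τ ∘ (a′ +_))                   ≡⟨ cong (∑ a′ τ +_) (∑-split d 1 (τ ∘ (a′ +_))) ⟩
      ∑ a′ τ + (∑ d (τ ∘ (a′ +_)) + (0 + τ (a′ + (d + 0))))
        ≡⟨ cong₂ _+_ (∑-cong a′ λ _ i<a′ → cong (touch S) (edge-path i<a′))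
                     (cong₂ _+_ (∑-cong d λ _ → leaf-touched) last-touched) ⟩
      pathEdges s a′ + (leafEdges s d + ⟦ s a′ ⟧)        ≡⟨ +-assoc (pathEdges s a′) _ _ ⟨
      pathEdges s a′ + leafEdges s d + ⟦ s a′ ⟧          ∎
      where
      open ≡-Reasoning
      τ = touch S ∘ edge
      b≡a′+[d+1] : b ≡ a′ + (d + 1)
      b≡a′+[d+1] = trans (sym a+d≡b) (trans (sym (+-suc a′ d)) (cong (a′ +_) (+-comm 1 d)))
      leaf-touched : ∀ {k} → k < d → τ (a′ + k) ≡ ⟦ s (leafParent k) ⟧
      leaf-touched {k} k<d rewrite edge-leaf k<d | s-leaf (m≤m+n a k) (leaf≤b (m≤n⇒m≤1+n k<d)) = refl
      last-touched : 0 + τ (a′ + (d + 0)) ≡ ⟦ s a′ ⟧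
      last-touched rewrite +-identityʳ d | edge-last | s-leaf (<⇒≤ a<b) ≤-refl = refl

    T₂-part : b * ∑ a (⟦_⟧ ∘ s) ≤ a * ∑ b (touch S ∘ edge)
    T₂-part = subst₂ (λ x y → x * ∑ a (⟦_⟧ ∘ s) ≤ a * y) a+d≡b (sym T₂-touching) (balanced s)

    triangle-part : 3 * b * ∑ b (⟦_⟧ ∘ s ∘ (suc b +_)) + 3 * a * ∑ b (touch S ∘ edge)
                    ≤ (a + b) * (∑ b (touch S ∘ edge) + ∑ b (sides S))
    triangle-part = begin
      3 * b * ∑ b w + 3 * a * ∑ b τ
        ≡⟨ cong₂ _+_ (∑-distribˡ-* b (3 * b) w) (∑-distribˡ-* b (3 * a) τ) ⟨
      ∑ b (λ m → 3 * b * w m) + ∑ b (λ m → 3 * a * τ m)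
        ≡⟨ ∑-distrib-+ b (λ m → 3 * b * w m) (λ m → 3 * a * τ m) ⟨
      ∑ b (λ m → 3 * b * w m + 3 * a * τ m)
        ≤⟨ ∑-mono-≤ b (λ m _ →
             triangle-balance (<⇒≤ a<b) b≤2a (s (proj₁ (edge m))) (s (proj₂ (edge m))) (s (suc b + m))) ⟩
      ∑ b (λ m → (a + b) * (τ m + sides S m))  ≡⟨ ∑-distribˡ-* b (a + b) (λ m → τ m + sides S m) ⟩
      (a + b) * ∑ b (λ m → τ m + sides S m)    ≡⟨ cong ((a + b) *_) (∑-distrib-+ b τ (sides S)) ⟩
      (a + b) * (∑ b τ + ∑ b (sides S))        ∎
      where
      open ≤-Reasoning
      τ = touch S ∘ edge
      w = ⟦_⟧ ∘ s ∘ (suc b +_)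

    balance-inequality : 3 * b * ∣ S ∣ ≤ eS (T₃ a b) S * (a + b)
    balance-inequality = begin
      3 * b * ∣ S ∣                        ≡⟨ cong (3 * b *_) ∣S∣≡ ⟩
      3 * b * (∑ a (⟦_⟧ ∘ s) + W)           ≡⟨ distrib b (∑ a (⟦_⟧ ∘ s)) W ⟩
      3 * (b * ∑ a (⟦_⟧ ∘ s)) + 3 * b * W   ≤⟨ +-monoˡ-≤ (3 * b * W) (*-monoʳ-≤ 3 T₂-part) ⟩
      3 * (a * E) + 3 * b * W               ≡⟨ rearrange a b E W ⟩
      3 * b * W + 3 * a * E                 ≤⟨ triangle-part ⟩
      (a + b) * (E + ∑ b (sides S))         ≡⟨ *-comm (a + b) _ ⟩
      (E + ∑ b (sides S)) * (a + b)         ≡⟨ cong (_* (a + b)) (eS-T₃ S) ⟨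
      eS (T₃ a b) S * (a + b)               ∎
      where
      open ≤-Reasoning
      E = ∑ b (touch S ∘ edge)
      W = ∑ b (⟦_⟧ ∘ s ∘ (suc b +_))
      distrib : ∀ b P W → 3 * b * (P + W) ≡ 3 * (b * P) + 3 * b * W
      distrib = solve-∀
      rearrange : ∀ a b E W → 3 * (a * E) + 3 * b * W ≡ 3 * b * W + 3 * a * E
      rearrange = solve-∀

  T₃-balanced : Balanced (T₃ a b)
  T₃-balanced S S⊆nonRoots S≢∅ = subst (ℚ._≤ density (T₃ a b) S) (sym rootedDensity-T₃)
    (frac-≤ (3 * b) (eS (T₃ a b) S) z<s (nonempty⇒∣p∣>0 S≢∅) (Balance.balance-inequality S S⊆nonRoots))

-- T₃(a, b) is a K₃-tree

module K₃Tree (a′ b : ℕ) (a+1≤b : suc a′ + 1 ≤ b) (b≤2a : b ≤ 2 * suc a′) where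

  open BukhConlon a′ b a+1≤b b≤2a

  TriangleVertex : ℕ → ℕ → Set
  TriangleVertex m t = t ≡ proj₁ (edge m) ⊎ t ≡ proj₂ (edge m) ⊎ t ≡ suc b + m

  inTriangle : ℕ → ℕ → Bool
  inTriangle m t = (t ≡ᵇ proj₁ (edge m)) ∨ (t ≡ᵇ proj₂ (edge m)) ∨ (t ≡ᵇ suc b + m)

  inTriangle⁺ : ∀ {m t} → TriangleVertex m t → inTriangle m t ≡ true
  inTriangle⁺ {m} {t} (inj₁ refl) rewrite ≡ᵇ-refl t = refl
  inTriangle⁺ {m} {t} (inj₂ (inj₁ refl)) rewrite ≡ᵇ-refl t = ∨-zeroʳ _
  inTriangle⁺ {m} {t} (inj₂ (inj₂ refl)) rewrite ≡ᵇ-refl t =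
    trans (cong ((t ≡ᵇ proj₁ (edge m)) ∨_) (∨-zeroʳ _)) (∨-zeroʳ _)

  inTriangle⁻ : ∀ {m t} → inTriangle m t ≡ true → TriangleVertex m t
  inTriangle⁻ {m} {t} eq with t ≡ᵇ proj₁ (edge m) in t≡x | t ≡ᵇ proj₂ (edge m) in t≡y
  ... | true | _ = inj₁ (≡ᵇ≡true⇒≡ _ _ t≡x)
  ... | false | true = inj₂ (inj₁ (≡ᵇ≡true⇒≡ _ _ t≡y))
  ... | false | false = inj₂ (inj₂ (≡ᵇ≡true⇒≡ _ _ eq))

  triangle : Fin b → Subset (size (T₃ a b))
  triangle i = Vec.tabulate (inTriangle (toℕ i) ∘ toℕ)

  ∈-triangle⁺ : ∀ {i v} → TriangleVertex (toℕ i) (toℕ v) → v ∈ₛ triangle i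
  ∈-triangle⁺ {i} = ∈-tabulate⁺ (inTriangle (toℕ i) ∘ toℕ) ∘ inTriangle⁺

  ∈-triangle⁻ : ∀ {i v} → v ∈ₛ triangle i → TriangleVertex (toℕ i) (toℕ v)
  ∈-triangle⁻ {i} = inTriangle⁻ ∘ ∈-tabulate⁻ (inTriangle (toℕ i) ∘ toℕ)

  triangleVertex-≤ : ∀ {j t} → j < b → TriangleVertex j t → t ≤ suc j ⊎ t ≡ suc b + j
  triangleVertex-≤ j<b (inj₁ refl) = inj₁ (proj₁ (edge-≤ j<b))
  triangleVertex-≤ j<b (inj₂ (inj₁ refl)) = inj₁ (proj₂ (edge-≤ j<b))
  triangleVertex-≤ j<b (inj₂ (inj₂ refl)) = inj₂ refl

  hang-vertices : ∀ {m} (h : Hangs m) → TriangleVertex m (Hangs.parent h) × TriangleVertex m (suc m)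
  hang-vertices record { orient = inj₁ eq } = inj₁ (cong proj₁ (sym eq)) , inj₂ (inj₁ (cong proj₂ (sym eq)))
  hang-vertices record { orient = inj₂ eq } = inj₂ (inj₁ (cong proj₂ (sym eq))) , inj₁ (cong proj₁ (sym eq))

  cover : ∀ {t} → t ≤ b → TriangleVertex (t ∸ 1) t
  cover {zero} _ = subst (TriangleVertex 0) (n≤0⇒n≡0 (Hangs.parent≤m h₀)) (proj₁ (hang-vertices h₀))
    where h₀ = hangs (<-trans z<s a<b)
  cover {suc t} 1+t≤b = proj₂ (hang-vertices (hangs 1+t≤b))

  Fresh : ℕ → ℕ → Set
  Fresh m t = ∀ {j} → j < m → ¬ TriangleVertex j t

  fresh-new : ∀ {m} → m < b → Fresh m (suc m)
  fresh-new {m} m<b {j} j<m v with triangleVertex-≤ (<-trans j<m m<b) v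
  ... | inj₁ 1+m≤1+j = <⇒≱ j<m (≤-pred 1+m≤1+j)
  ... | inj₂ 1+m≡1+b+j = <⇒≱ m<b (subst (b ≤_) (sym (suc-injective 1+m≡1+b+j)) (m≤m+n b j))

  fresh-apex : ∀ {m} → m < b → Fresh m (suc b + m)
  fresh-apex {m} m<b {j} j<m v with triangleVertex-≤ (<-trans j<m m<b) v
  ... | inj₁ apex≤1+j = <⇒≱ (<-trans j<m m<b) (≤-trans (m≤m+n b m) (≤-pred apex≤1+j))
  ... | inj₂ apex≡ = <-irrefl (sym (+-cancelˡ-≡ (suc b) m j apex≡)) j<m

  vertex-cases : ∀ {m t} (h : Hangs m) → m < b → TriangleVertex m t → t ≡ Hangs.parent h ⊎ Fresh m t
  vertex-cases record { orient = inj₁ eq } m<b (inj₁ refl) = inj₁ (cong proj₁ eq)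
  vertex-cases record { orient = inj₂ eq } m<b (inj₁ refl) =
    inj₂ (subst (Fresh _) (sym (cong proj₁ eq)) (fresh-new m<b))
  vertex-cases record { orient = inj₁ eq } m<b (inj₂ (inj₁ refl)) =
    inj₂ (subst (Fresh _) (sym (cong proj₂ eq)) (fresh-new m<b))
  vertex-cases record { orient = inj₂ eq } m<b (inj₂ (inj₁ refl)) = inj₁ (cong proj₂ eq)
  vertex-cases h m<b (inj₂ (inj₂ refl)) = inj₂ (fresh-apex m<b)

  t∸1<n : ∀ {t n} → 0 < n → t ≤ n → t ∸ 1 < n
  t∸1<n {zero} 0<n _ = 0<n
  t∸1<n {suc t} _ 1+t≤n = 1+t≤n

  <size : ∀ {v} → v < suc b + b → v < size (T₃ a b)
  <size {v} = subst (v <_) (sym T₃-size)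

  triangle-card : ∀ i → ∣ triangle i ∣ ≡ 3
  triangle-card i = begin
    ∣ triangle i ∣
      ≡⟨ ∣p∣≡∑ (triangle i) ⟩
    ∑ N (⟦_⟧ ∘ memℕ (triangle i))
      ≡⟨ ∑-cong N (λ _ v<N → cong ⟦_⟧ (memℕ-tabulate N (inTriangle m) v<N)) ⟩
    ∑ N (⟦_⟧ ∘ inTriangle m)
      ≡⟨ ∑-indicator₃ N (edge-loopless m<b) (<⇒≢ x<w) (<⇒≢ y<w)
           (<size (≤b⇒<size x≤b)) (<size (≤b⇒<size y≤b)) (<size (+-monoʳ-< (suc b) m<b)) ⟩
    3 ∎
    where
    open ≡-Reasoning
    N = size (T₃ a b)
    m = toℕ i
    m<b = toℕ<n i
    x≤b = proj₁ (edge-≤b m<b)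
    y≤b = proj₂ (edge-≤b m<b)
    x<w = s≤s (≤-trans x≤b (m≤m+n b m))
    y<w = s≤s (≤-trans y≤b (m≤m+n b m))

  triangle-adjacent : ∀ {m u v} → m < b → TriangleVertex m u → TriangleVertex m v → u ≢ v →
    adjB T₃-edgeList u v ≡ true
  triangle-adjacent {m} m<b = adjacent
    where
    xy : adjB T₃-edgeList (proj₁ (edge m)) (proj₂ (edge m)) ≡ true
    xy = ∈⇒adjB (∈-++⁺ˡ (∈-applyUpTo⁺ edge m<b))
    xw : adjB T₃-edgeList (proj₁ (edge m)) (suc b + m) ≡ true
    xw = ∈⇒adjB (∈-++⁺ʳ (applyUpTo edge b) (proj₁ (∈-triangles b (suc b) edge m<b)))
    yw : adjB T₃-edgeList (proj₂ (edge m)) (suc b + m) ≡ true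
    yw = ∈⇒adjB (∈-++⁺ʳ (applyUpTo edge b) (proj₂ (∈-triangles b (suc b) edge m<b)))
    flip : ∀ {u v} → adjB T₃-edgeList u v ≡ true → adjB T₃-edgeList v u ≡ true
    flip {u} {v} = trans (adjB-sym T₃-edgeList v u)
    adjacent : ∀ {u v} → TriangleVertex m u → TriangleVertex m v → u ≢ v → adjB T₃-edgeList u v ≡ true
    adjacent (inj₁ refl) (inj₁ refl) u≢v = ⊥-elim (u≢v refl)
    adjacent (inj₁ refl) (inj₂ (inj₁ refl)) _ = xy
    adjacent (inj₁ refl) (inj₂ (inj₂ refl)) _ = xw
    adjacent (inj₂ (inj₁ refl)) (inj₁ refl) _ = flip xy
    adjacent (inj₂ (inj₁ refl)) (inj₂ (inj₁ refl)) u≢v = ⊥-elim (u≢v refl)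
    adjacent (inj₂ (inj₁ refl)) (inj₂ (inj₂ refl)) _ = yw
    adjacent (inj₂ (inj₂ refl)) (inj₁ refl) _ = flip xw
    adjacent (inj₂ (inj₂ refl)) (inj₂ (inj₁ refl)) _ = flip yw
    adjacent (inj₂ (inj₂ refl)) (inj₂ (inj₂ refl)) u≢v = ⊥-elim (u≢v refl)

  triangle-clique : ∀ i → IsClique 3 (T₃ a b) (triangle i)
  triangle-clique i = triangle-card i , λ u v u∈ v∈ u≢v →
    subst (λ es → adjB es (toℕ u) (toℕ v) ≡ true) (sym T₃-edges)
      (triangle-adjacent (toℕ<n i) (∈-triangle⁻ u∈) (∈-triangle⁻ v∈) (u≢v ∘ toℕ-injective))

  coverage : ∀ v → ∃[ i ] v ∈ₛ triangle i
  coverage v with toℕ v ≤? b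
  ... | yes v≤b = fromℕ< t∸1<b ,
    ∈-triangle⁺ (subst (λ j → TriangleVertex j (toℕ v)) (sym (toℕ-fromℕ< t∸1<b)) (cover v≤b))
    where t∸1<b = t∸1<n (<-trans z<s a<b) v≤b
  ... | no v≰b = fromℕ< m<b ,
    ∈-triangle⁺ (subst₂ TriangleVertex (sym (toℕ-fromℕ< m<b)) (sym v≡apex) (inj₂ (inj₂ refl)))
    where
    m = toℕ v ∸ suc b
    v≡apex : toℕ v ≡ suc b + m
    v≡apex = sym (m+[n∸m]≡n (≰⇒> v≰b))
    m<b : m < b
    m<b = +-cancelˡ-< (suc b) m b (subst (_< suc b + b) v≡apex (subst (toℕ v <_) T₃-size (toℕ<n v)))

  module Attachment (i : Fin b) (0<i : 0 < toℕ i) where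

    m = toℕ i
    m<b = toℕ<n i
    h = hangs m<b
    p = Hangs.parent h

    p∸1<b : p ∸ 1 < b
    p∸1<b = <-trans (t∸1<n 0<i (Hangs.parent≤m h)) m<b

    j : Fin b
    j = fromℕ< p∸1<b

    j<i : j Fin.< i
    j<i = subst (_< m) (sym (toℕ-fromℕ< p∸1<b)) (t∸1<n 0<i (Hangs.parent≤m h))

    p∈j : TriangleVertex (toℕ j) p
    p∈j = subst (λ k → TriangleVertex k p) (sym (toℕ-fromℕ< p∸1<b))
      (cover (≤-trans (<⇒≤ (Hangs.parent<a h)) (<⇒≤ a<b)))

    ∩-earlier : triangle i ∩ earlier triangle i ≡ triangle i ∩ triangle j
    ∩-earlier = ⊆-antisym ⊆j ⊇j
      where
      ⊆j : ∀ {x} → x ∈ₛ triangle i ∩ earlier triangle i → x ∈ₛ triangle i ∩ triangle j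
      ⊆j x∈ with x∈p∩q⁻ (triangle i) _ x∈
      ... | x∈i , x∈earlier with ∈-earlier⁻ triangle x∈earlier | vertex-cases h m<b (∈-triangle⁻ x∈i)
      ...   | _ , _ , _ | inj₁ x≡p =
        x∈p∩q⁺ (x∈i , ∈-triangle⁺ (subst (TriangleVertex (toℕ j)) (sym x≡p) p∈j))
      ...   | _ , k<i , x∈k | inj₂ fresh = ⊥-elim (fresh k<i (∈-triangle⁻ x∈k))
      ⊇j : ∀ {x} → x ∈ₛ triangle i ∩ triangle j → x ∈ₛ triangle i ∩ earlier triangle i
      ⊇j x∈ with x∈p∩q⁻ (triangle i) (triangle j) x∈
      ... | x∈i , x∈j = x∈p∩q⁺ (x∈i , ∈-earlier⁺ triangle j<i x∈j)

    nonempty : Nonempty (triangle i ∩ triangle j)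
    nonempty = fromℕ< p<size , x∈p∩q⁺
      (∈-triangle⁺ (subst (TriangleVertex m) (sym p≡) (proj₁ (hang-vertices h))) ,
       ∈-triangle⁺ (subst (TriangleVertex (toℕ j)) (sym p≡) p∈j))
      where
      p<size = <size (≤b⇒<size (≤-trans (<⇒≤ (Hangs.parent<a h)) (<⇒≤ a<b)))
      p≡ = toℕ-fromℕ< p<size

    proper : triangle i ∩ triangle j ≢ triangle i
    proper eq = fresh-apex m<b j<i (subst (TriangleVertex (toℕ j)) (toℕ-fromℕ< apex<size)
      (∈-triangle⁻ (proj₂ (x∈p∩q⁻ (triangle i) (triangle j) apex∈i∩j))))
      where
      apex<size = <size (+-monoʳ-< (suc b) m<b)
      apex∈i : fromℕ< apex<size ∈ₛ triangle i
      apex∈i = ∈-triangle⁺ (inj₂ (inj₂ (toℕ-fromℕ< apex<size)))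
      apex∈i∩j : fromℕ< apex<size ∈ₛ triangle i ∩ triangle j
      apex∈i∩j = subst (fromℕ< apex<size ∈ₛ_) (sym eq) apex∈i

  T₃-isK₃Tree : IsKTree 3 (T₃ a b)
  T₃-isK₃Tree = b , triangle , triangle-clique , coverage , λ i 0<i →
    let open Attachment i 0<i in j , j<i , ∩-earlier , nonempty , proper

proposition4p2 : (a b : ℕ) → a + 1 ≤ b → b ≤ 2 * a →
    IsKTree 3 (T₃ a b) × Balanced (T₃ a b) × (rootedDensity (T₃ a b) ≡ frac (3 * b) (a + b))
proposition4p2 zero b 1≤b b≤0 with ≤-trans 1≤b b≤0
... | ()
proposition4p2 (suc a′) b a+1≤b b≤2a =
  K₃Tree.T₃-isK₃Tree a′ b a+1≤b b≤2a ,
  BukhConlon.T₃-balanced a′ b a+1≤b b≤2a ,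
  BukhConlon.rootedDensity-T₃ a′ b a+1≤b b≤2a
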